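{- Let $K$ be an even positive integer, let $G=(V,E)$ be a $K$-edge-connected graph with a cactus representation $(\mathfrak C_G,\phi)$, and let $\widetilde T$ be a spanning tree of $G$ with congestion at most $K$. Let $C=a_0-a_1-\cdots-a_{\ell-1}-a_0$ be a cycle of $\mathfrak C_G$ of length $\ell\ge 3$, with indices taken modulo $\ell$. For each $i$, let $Q_i$ be the shore containing $a_i$ of the $2$-cut of $\mathfrak C_G$ formed by the links $(a_{i-1},a_i)$ and $(a_i,a_{i+1})$, and let $Z_i=\phi^{ -1}(Q_i)$. Then there exist an index $g$ and vertices $w_g,w_{g+1},\ldots,w_{g+\ell-1}$ (so $w_{g+\ell-1}=w_{g-1}$) with $w_i\in Z_i$ for all $i=g,\ldots,g+\ell-1$, such that: (i) $\widetilde T\cap\delta(Z_i)\cap\delta(Z_{i+1})=\{(w_i,w_{i+1})\}$ for $i=g+1,\ldots,g+\ell-3$; (ii) $(w_g,w_{g+1})\in\widetilde T\cap\delta(Z_g)\cap\delta(Z_{g+1})\subseteq E_{w_{g+1}}$ and $(w_{g-2},w_{g-1})\in\widetilde T\cap\delta(Z_{g-1})\cap\delta(Z_{g-2})\subseteq E_{w_{g-2}}$; (iii) $\widetilde T\cap\delta(Z_g)\cap\delta(Z_{g-1})=\emptyset$.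
   Context: For $\emptyset\neq X\subsetneq V$, $\delta(X)$ is the set of edges of $G$ with exactly one endpoint in $X$; it is a $K$-cut if $|\delta(X)|=K$. $E_w$ is the set of edges incident with $w$. $G$ is $K$-edge-connected if it is connected and stays connected after deleting any $K-1$ edges. For a spanning tree $T$ and $e\in T$, the congestion of $e$ is $|\delta(S)|$ where $S$ is the vertex set of a component of $T-e$; the congestion of $T$ is the maximum over its edges. A cactus is a connected multigraph (nodes and links) in which every link lies on exactly one cycle (cycles of length $2$ allowed). A cactus representation of $G$ is a cactus $\mathfrak C_G=(U,F)$ with a map $\phi:V\to U$ such that for every $X\subseteq V$, $\delta(X)$ is a $K$-cut of $G$ iff $X=\phi^{ -1}(Q)$ for some $Q\subseteq U$ such that exactly two links join $Q$ and $U\setminus Q$ (a $2$-cut of $\mathfrak C_G$). -}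

module Defs where

open import Data.Nat using (ℕ; zero; suc; _+_; _≤_; _∸_)
open import Data.Nat.DivMod using (_mod_)
open import Data.Fin using (Fin; toℕ)
open import Data.Fin.Properties using (_≟_)
open import Data.Bool using (Bool; true; false; _∧_; not; _xor_; if_then_else_)
open import Data.Product using (Σ; ∃; _×_; _,_; proj₁; proj₂)
open import Data.Sum using (_⊎_)
open import Relation.Binary.PropositionalEquality using (_≡_; _≢_)
open import Relation.Nullary using (¬_)
open import Relation.Nullary.Decidable using (⌊_⌋)
open import Function.Definitions using (Injective)
open import Function.Bundles using (_⇔_)

record Multigraph : Set where
  field
    n        : ℕ
    m        : ℕ
    ends     : Fin m → Fin n × Fin n
    loopless : ∀ e → proj₁ (ends e) ≢ proj₂ (ends e)
open Multigraph public

VSet : Multigraph → Set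
VSet G = Fin (n G) → Bool

ESet : Multigraph → Set
ESet G = Fin (m G) → Bool

count : ∀ {k} → (Fin k → Bool) → ℕ
count {zero}  p = 0
count {suc k} p = (if p Fin.zero then 1 else 0) + count (λ i → p (Fin.suc i))
  where import Data.Fin as Fin

allEdges : (G : Multigraph) → ESet G
allEdges G _ = true

Joins : (G : Multigraph) → Fin (m G) → Fin (n G) → Fin (n G) → Set
Joins G e u v = ends G e ≡ (u , v) ⊎ ends G e ≡ (v , u)

Incident : (G : Multigraph) → Fin (m G) → Fin (n G) → Set
Incident G e w = proj₁ (ends G e) ≡ w ⊎ proj₂ (ends G e) ≡ w

data Reach (G : Multigraph) (S : ESet G) : Fin (n G) → Fin (n G) → Set where
  here : ∀ {u} → Reach G S u u
  step : ∀ {u v w} (e : Fin (m G)) → S e ≡ true → Joins G e u v →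
         Reach G S v w → Reach G S u w

Connected : (G : Multigraph) → ESet G → Set
Connected G S = ∀ u v → Reach G S u v

cross : (G : Multigraph) → VSet G → ESet G
cross G X e = X (proj₁ (ends G e)) xor X (proj₂ (ends G e))

NonemptyV : (G : Multigraph) → VSet G → Set
NonemptyV G X = ∃ λ v → X v ≡ true

ProperV : (G : Multigraph) → VSet G → Set
ProperV G X = ∃ λ v → X v ≡ false

IsKCut : (G : Multigraph) → ℕ → VSet G → Set
IsKCut G K X = NonemptyV G X × ProperV G X × count (cross G X) ≡ K

KEdgeConnected : Multigraph → ℕ → Set
KEdgeConnected G K =
  Connected G (allEdges G) ×
  (∀ (F : ESet G) → count F ≤ K ∸ 1 → Connected G (λ e → not (F e)))

shift : ∀ {k} → Fin (suc k) → ℕ → Fin (suc k)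
shift {k} i j = (toℕ i + j) mod (suc k)

IsCycle : (G : Multigraph) (k : ℕ) → (Fin (suc k) → Fin (n G)) →
          (Fin (suc k) → Fin (m G)) → Set
IsCycle G k a c =
  Injective _≡_ _≡_ a × Injective _≡_ _≡_ c ×
  (∀ i → Joins G (c i) (a i) (a (shift i 1)))

record Cycle (G : Multigraph) : Set where
  field
    k       : ℕ
    nodes   : Fin (suc k) → Fin (n G)
    links   : Fin (suc k) → Fin (m G)
    isCycle : IsCycle G k nodes links

OnCycle : (G : Multigraph) → Cycle G → Fin (m G) → Set
OnCycle G C f = ∃ λ i → Cycle.links C i ≡ f

SameCycle : (G : Multigraph) → Cycle G → Cycle G → Set
SameCycle G C D = ∀ f → OnCycle G C f ⇔ OnCycle G D f

IsCactus : Multigraph → Set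
IsCactus C =
  Connected C (allEdges C) ×
  (∀ f → (Σ (Cycle C) λ D → OnCycle C D f) ×
         (∀ D D' → OnCycle C D f → OnCycle C D' f → SameCycle C D D'))

IsTwoCut : (C : Multigraph) → VSet C → Set
IsTwoCut C Q = count (cross C Q) ≡ 2

record CactusRep (G : Multigraph) (K : ℕ) : Set where
  field
    cactus   : Multigraph
    isCactus : IsCactus cactus
    φ        : Fin (n G) → Fin (n cactus)
    represents : ∀ (X : VSet G) →
      IsKCut G K X ⇔ (Σ (VSet cactus) λ Q → IsTwoCut cactus Q × (∀ v → X v ≡ Q (φ v)))

Acyclic : (G : Multigraph) → ESet G → Set
Acyclic G T = ¬ (Σ (Cycle G) λ D → ∀ i → T (Cycle.links D i) ≡ true)

IsSpanningTree : (G : Multigraph) → ESet G → Set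
IsSpanningTree G T = Connected G T × Acyclic G T

IsComponent : (G : Multigraph) → ESet G → VSet G → Set
IsComponent G R S =
  NonemptyV G S ×
  (∀ u v → S u ≡ true → S v ≡ true → Reach G R u v) ×
  (∀ u v → S u ≡ true → Reach G R u v → S v ≡ true)

removeEdge : (G : Multigraph) → ESet G → Fin (m G) → ESet G
removeEdge G T e f = T f ∧ not ⌊ f ≟ e ⌋

CongestionAtMost : (G : Multigraph) → ESet G → ℕ → Set
CongestionAtMost G T K =
  ∀ e → T e ≡ true → ∀ S → IsComponent G (removeEdge G T e) S →
  count (cross G S) ≤ K

TδΔ : (G : Multigraph) → ESet G → VSet G → VSet G → ESet G
TδΔ G T X Y e = T e ∧ cross G X e ∧ cross G Y e

module Submission where

-- The shores Q i partition the cactus nodes, hence the vertices of G, into ℓ cyclically ordered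
-- blocks Z i. Both Z i and Z i ∪ Z (i + 1) are K-cuts, and comparing their sizes shows that every
-- edge of G joins equal or neighbouring blocks. Each fundamental cut of the tree is a K-cut
-- (congestion at most K against K-edge-connectivity), so through the cactus it is a union of
-- blocks, or lies inside one block, or its complement does. Call x a core vertex if no tree edge
-- cuts off a side containing x that lies inside the block of x without filling it. Such hidden
-- sides are nested, so every vertex hangs below a core vertex, and a block holds at most one core
-- vertex. This rules out tree edges between all pairs of consecutive blocks, which gives g with
-- no tree edge between Z (g - 1) and Z g. The tree path from Z g to Z (g - 1) must then step over
-- every other boundary, each inner block contains a core vertex w, and every tree edge leaving an
-- inner block starts at w.

open import Defs
open import Data.Nat using (_%_; _*_; _+_; _<?_; _<_; _∸_; _≤?_; _≤_; suc; s≤s; zero; z≤n; ℕ)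
open import Data.Nat.Properties using (*-cancelˡ-≡; +-assoc; +-cancelˡ-≡; +-cancelˡ-≤; +-comm; +-identityʳ; 1+n≢n; 1+n≰n; <-irrefl; <⇒≢; <⇒≤; m+[n∸m]≡n; m≤n+m; m≤n⇒m≤1+n; n<1+n; n≤0⇒n≡0; n≤1+n; pred[m∸n]≡m∸[1+n]; suc-injective; suc[m]≤n⇒m≤pred[n]; ≤-antisym; ≤-pred; ≤-refl; ≤-trans; ≰⇒>; module ≤-Reasoning)
open import Data.Nat.DivMod using (%-distribˡ-+; [m+n]%n≡m%n; m%n%n≡m%n; m%n<n; m<n⇒m%n≡m; n%n≡0)
open import Data.Nat.Divisibility using (_∣_)
open import Data.Nat.Solver using (module +-*-Solver)
open import Data.Fin using (Fin; fromℕ; inject₁; suc; toℕ; zero)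
open import Data.Fin.Properties using (_≟_; all?; any?; injective⇒≤; inject₁-injective; toℕ-fromℕ; toℕ-fromℕ<; toℕ-injective; toℕ-inject₁; toℕ<n; ¬∀⟶∃¬)
open import Data.Fin.Relation.Unary.Top using (view; view-fromℕ; ‵fromℕ; ‵inject₁)
open import Data.Bool using (Bool; _xor_; _∧_; _∨_; false; if_then_else_; not; true)
open import Data.Bool.Properties using (not-involutive; not-¬; xor-annihilates-not; xor-assoc; xor-comm; xor-same; ¬-not; ∧-comm; ∧-distribˡ-∨; ∧-identityʳ; ∧-zeroʳ; ∨-zeroʳ) renaming (_≟_ to _≟ᵇ_)
open import Data.Empty using (⊥; ⊥-elim)
open import Data.Unit using (tt; ⊤)
open import Data.Product using (_,_; _×_; proj₁; proj₂; Σ; ∃; ∃₂)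
open import Data.Product.Properties using (≡-dec)
open import Data.Sum using ([_,_]′; _⊎_; inj₁; inj₂)
open import Function using (_∘_)
open import Function.Bundles using (Equivalence; _⇔_; mk⇔)
open import Relation.Nullary using (Dec; contradiction; no; yes; ¬?; ¬_)
open import Relation.Nullary.Decidable using (_×-dec_; _→-dec_; _⊎-dec_; decidable-stable; map′; ⌊_⌋)
open import Relation.Binary.PropositionalEquality

_⊆_ : {A : Set} → (A → Bool) → (A → Bool) → Set
p ⊆ q = ∀ x → p x ≡ true → q x ≡ true

⌊⌋-sound : ∀ {P : Set} (d : Dec P) → ⌊ d ⌋ ≡ true → P
⌊⌋-sound (yes p) _ = p

⌊⌋-complete : ∀ {P : Set} (d : Dec P) → P → ⌊ d ⌋ ≡ true
⌊⌋-complete (yes _) _ = refl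
⌊⌋-complete (no ¬p) p = contradiction p ¬p

⌊⌋-false : ∀ {P : Set} (d : Dec P) → ¬ P → ⌊ d ⌋ ≡ false
⌊⌋-false (yes p) ¬p = contradiction p ¬p
⌊⌋-false (no _)  _  = refl

≡⇒xor≡false : ∀ {x y} → x ≡ y → x xor y ≡ false
≡⇒xor≡false {x} refl = xor-same x

xor≡false⇒≡ : ∀ {x y} → x xor y ≡ false → x ≡ y
xor≡false⇒≡ {true}  {true}  _ = refl
xor≡false⇒≡ {false} {false} _ = refl

xor≡true⇒≢ : ∀ {x y} → x xor y ≡ true → x ≢ y
xor≡true⇒≢ {x} x⊕y x≡y = contradiction (trans (sym x⊕y) (≡⇒xor≡false x≡y)) λ ()

≢⇒xor≡true : ∀ {x y} → x ≢ y → x xor y ≡ true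
≢⇒xor≡true {true}  {true}  x≢y = contradiction refl x≢y
≢⇒xor≡true {true}  {false} _   = refl
≢⇒xor≡true {false} {true}  _   = refl
≢⇒xor≡true {false} {false} x≢y = contradiction refl x≢y

not≡true⇒≡false : ∀ {b} → not b ≡ true → b ≡ false
not≡true⇒≡false {false} _ = refl

∧≡true : ∀ {x y} → x ∧ y ≡ true → x ≡ true × y ≡ true
∧≡true {true} {true} _ = refl , refl

xor≡true-right : ∀ {x y} → x ≡ false → x xor y ≡ true → y ≡ true
xor≡true-right refl x⊕y = x⊕y

xor≡true-left : ∀ {x y} → y ≡ false → x xor y ≡ true → x ≡ true
xor≡true-left {true}  refl _   = refl
xor≡true-left {false} refl ()

∨≡true : ∀ {x y} → x ∨ y ≡ true → x ≡ true ⊎ y ≡ true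
∨≡true {true}  _ = inj₁ refl
∨≡true {false} y = inj₂ y

delete : ∀ {k} → Fin k → (Fin k → Bool) → Fin k → Bool
delete a p i = p i ∧ not ⌊ i ≟ a ⌋

count-cong : ∀ {k} {p q : Fin k → Bool} → (∀ i → p i ≡ q i) → count p ≡ count q
count-cong {zero}  p≗q = refl
count-cong {suc k} p≗q = cong₂ (λ b n → (if b then 1 else 0) + n) (p≗q zero) (count-cong (p≗q ∘ suc))

count≤ : ∀ {k} (p : Fin k → Bool) → count p ≤ k
count≤ {zero}  p = z≤n
count≤ {suc k} p with p zero
... | true  = s≤s (count≤ (p ∘ suc))
... | false = m≤n⇒m≤1+n (count≤ (p ∘ suc))

count-mono : ∀ {k} {p q : Fin k → Bool} → p ⊆ q → count p ≤ count q
count-mono {zero}          p⊆q = z≤n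
count-mono {suc k} {p} {q} p⊆q with p zero in p₀ | q zero in q₀
... | true  | true  = s≤s (count-mono (p⊆q ∘ suc))
... | true  | false = contradiction (trans (sym (p⊆q zero p₀)) q₀) λ ()
... | false | true  = m≤n⇒m≤1+n (count-mono (p⊆q ∘ suc))
... | false | false = count-mono (p⊆q ∘ suc)

all-false⇒count≡0 : ∀ {k} {p : Fin k → Bool} → (∀ i → p i ≡ false) → count p ≡ 0
all-false⇒count≡0 {zero}  _  = refl
all-false⇒count≡0 {suc k} {p} p≡false rewrite p≡false zero = all-false⇒count≡0 (p≡false ∘ suc)

∈⇒count>0 : ∀ {k} (p : Fin k → Bool) {i} → p i ≡ true → 0 < count p
∈⇒count>0 p {zero}  pᵢ rewrite pᵢ = s≤s z≤n
∈⇒count>0 p {suc i} pᵢ = ≤-trans (∈⇒count>0 (p ∘ suc) pᵢ) (m≤n+m _ _)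

count≡0⇒false : ∀ {k} (p : Fin k → Bool) → count p ≡ 0 → ∀ i → p i ≡ false
count≡0⇒false p count≡0 i with p i in pᵢ
... | false = refl
... | true  = contradiction (subst (0 <_) count≡0 (∈⇒count>0 p pᵢ)) λ ()

count>0⇒∃ : ∀ {k} (p : Fin k → Bool) → 0 < count p → ∃ λ i → p i ≡ true
count>0⇒∃ {suc k} p count>0 with p zero in p₀
... | true  = zero , p₀
... | false with count>0⇒∃ (p ∘ suc) count>0
...   | i , pᵢ = suc i , pᵢ

private
  ⌊suc≟suc⌋ : ∀ {k} (i a : Fin k) → ⌊ suc i ≟ suc a ⌋ ≡ ⌊ i ≟ a ⌋
  ⌊suc≟suc⌋ i a with i ≟ a
  ... | yes _ = refl
  ... | no _  = refl

  delete-suc : ∀ {k} (p : Fin (suc k) → Bool) (a : Fin k) →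
               count (delete a (p ∘ suc)) ≡ count (delete (suc a) p ∘ suc)
  delete-suc p a = count-cong λ i → cong (λ b → p (suc i) ∧ not b) (sym (⌊suc≟suc⌋ i a))

count-delete : ∀ {k} (p : Fin k → Bool) {a} → p a ≡ true → count p ≡ suc (count (delete a p))
count-delete {suc k} p {zero} p₀ rewrite p₀ =
  cong suc (count-cong λ i → sym (∧-identityʳ (p (suc i))))
count-delete {suc k} p {suc a} pₐ with p zero
... | true  = cong suc (trans (count-delete (p ∘ suc) pₐ) (cong suc (delete-suc p a)))
... | false = trans (count-delete (p ∘ suc) pₐ) (cong suc (delete-suc p a))

count-< : ∀ {k} {p q : Fin k → Bool} → p ⊆ q → ∀ {x} → p x ≡ false → q x ≡ true →
              count p < count q
count-< {p = p} {q} p⊆q {x} pₓ qₓ =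
  subst (count p <_) (sym (count-delete q qₓ)) (s≤s (count-mono p⊆q-x))
  where
  p⊆q-x : p ⊆ delete x q
  p⊆q-x i pᵢ with i ≟ x
  ... | yes refl = contradiction (trans (sym pᵢ) pₓ) λ ()
  ... | no _     = trans (cong (_∧ true) (p⊆q i pᵢ)) refl

module _ {k : ℕ} (p : Fin k → Bool) {a b : Fin k} (a≢b : a ≢ b) (a∈p : p a ≡ true) (b∈p : p b ≡ true) where

  private
    rest : Fin k → Bool
    rest = delete b (delete a p)

    rest-b : delete a p b ≡ true
    rest-b with b ≟ a
    ... | yes b≡a = contradiction (sym b≡a) a≢b
    ... | no _    = trans (cong (_∧ true) b∈p) refl

    count≡2+rest : count p ≡ 2 + count rest
    count≡2+rest = trans (count-delete p a∈p) (cong suc (count-delete (delete a p) rest-b))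

  pair⇒count≡2 : (∀ l → p l ≡ true → l ≡ a ⊎ l ≡ b) → count p ≡ 2
  pair⇒count≡2 only = trans count≡2+rest (cong (2 +_) (all-false⇒count≡0 rest-empty))
    where
    rest-empty : ∀ l → rest l ≡ false
    rest-empty l with p l in pₗ | l ≟ a | l ≟ b
    ... | false | _     | _     = refl
    ... | true  | yes _ | _     = refl
    ... | true  | no _  | yes _ = refl
    ... | true  | no l≢a | no l≢b with only l pₗ
    ...   | inj₁ l≡a = contradiction l≡a l≢a
    ...   | inj₂ l≡b = contradiction l≡b l≢b

  count≡2⇒pair : count p ≡ 2 → ∀ l → p l ≡ true → l ≡ a ⊎ l ≡ b
  count≡2⇒pair count≡2 l pₗ with l ≟ a | l ≟ b
  ... | yes l≡a | _       = inj₁ l≡a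
  ... | no _    | yes l≡b = inj₂ l≡b
  ... | no l≢a  | no l≢b  = contradiction (count≡0⇒false rest rest≡0 l) rest-l
    where
    rest≡0 : count rest ≡ 0
    rest≡0 = suc-injective (suc-injective (trans (sym count≡2+rest) count≡2))
    rest-l : rest l ≢ false
    rest-l rest-l≡false with l ≟ a | l ≟ b
    ... | yes l≡a | _ = l≢a l≡a
    ... | no _ | yes l≡b = l≢b l≡b
    ... | no _ | no _ rewrite pₗ = contradiction rest-l≡false λ ()

count≡2⇒∃pair : ∀ {k} (p : Fin k → Bool) → count p ≡ 2 →
                ∃₂ λ a b → a ≢ b × p a ≡ true × p b ≡ true
count≡2⇒∃pair p count≡2 with count>0⇒∃ p (subst (0 <_) (sym count≡2) (s≤s z≤n))
... | a , pₐ with count>0⇒∃ (delete a p) (subst (0 <_) (sym (suc-injective (trans (sym (count-delete p pₐ)) count≡2))) (s≤s z≤n))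
...   | b , p-a-b with b ≟ a | p b in p_b
...     | no b≢a | true = a , b , (λ a≡b → b≢a (sym a≡b)) , pₐ , p_b
...     | yes _  | true  = contradiction p-a-b λ ()
...     | _      | false = contradiction p-a-b λ ()

count-xor : ∀ {k} (p q : Fin k → Bool) →
            count p + count q ≡ count (λ i → p i xor q i) + 2 * count (λ i → p i ∧ q i)
count-xor {zero}  p q = refl
count-xor {suc k} p q =
  regroup #⟨ p zero ⟩ #⟨ q zero ⟩ #⟨ p zero xor q zero ⟩ #⟨ p zero ∧ q zero ⟩
    (head (p zero) (q zero)) (count-xor (p ∘ suc) (q ∘ suc))
  where
  #⟨_⟩ : Bool → ℕ
  #⟨ b ⟩ = if b then 1 else 0
  head : ∀ x y → #⟨ x ⟩ + #⟨ y ⟩ ≡ #⟨ x xor y ⟩ + 2 * #⟨ x ∧ y ⟩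
  head true  true  = refl
  head true  false = refl
  head false true  = refl
  head false false = refl
  open +-*-Solver using (solve; _:+_; _:*_; _:=_; con)
  regroup : ∀ a b c d {m n r s} → a + b ≡ c + 2 * d → m + n ≡ r + 2 * s →
            (a + m) + (b + n) ≡ (c + r) + 2 * (d + s)
  regroup a b c d {m} {n} {r} {s} e₁ e₂ = begin
    (a + m) + (b + n)       ≡⟨ solve 4 (λ a b m n → (a :+ m) :+ (b :+ n) := (a :+ b) :+ (m :+ n)) refl a b m n ⟩
    (a + b) + (m + n)       ≡⟨ cong₂ _+_ e₁ e₂ ⟩
    (c + 2 * d) + (r + 2 * s) ≡⟨ solve 4 (λ c d r s → (c :+ con 2 :* d) :+ (r :+ con 2 :* s) := (c :+ r) :+ con 2 :* (d :+ s)) refl c d r s ⟩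
    (c + r) + 2 * (d + s)   ∎
    where open ≡-Reasoning

count-∨ : ∀ {k} (p q : Fin k → Bool) → (∀ i → p i ∧ q i ≡ false) →
          count (λ i → p i ∨ q i) ≡ count p + count q
count-∨ p q disjoint = begin
  count (λ i → p i ∨ q i)                                        ≡⟨ count-cong ∨≗xor ⟩
  count (λ i → p i xor q i)                                      ≡⟨ sym (+-identityʳ _) ⟩
  count (λ i → p i xor q i) + 0                                  ≡⟨ cong (λ n → count (λ i → p i xor q i) + 2 * n) (sym (all-false⇒count≡0 disjoint)) ⟩
  count (λ i → p i xor q i) + 2 * count (λ i → p i ∧ q i)         ≡⟨ sym (count-xor p q) ⟩
  count p + count q                                              ∎
  where
  open ≡-Reasoning
  ∨≗xor : ∀ i → p i ∨ q i ≡ p i xor q i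
  ∨≗xor i with p i | q i | disjoint i
  ... | true  | false | _  = refl
  ... | false | _     | _  = refl
  ... | true  | true  | ()

module _ {L : ℕ} where

  private
    N : ℕ
    N = suc L

  toℕ-shift : (i : Fin N) (j : ℕ) → toℕ (shift i j) ≡ (toℕ i + j) % N
  toℕ-shift i j = toℕ-fromℕ< _

  private
    %-absorbʳ : ∀ a b → (a + b % N) % N ≡ (a + b) % N
    %-absorbʳ a b = begin
      (a + b % N) % N            ≡⟨ %-distribˡ-+ a (b % N) N ⟩
      (a % N + b % N % N) % N    ≡⟨ cong (λ x → (a % N + x) % N) (m%n%n≡m%n b N) ⟩
      (a % N + b % N) % N        ≡⟨ %-distribˡ-+ a b N ⟨
      (a + b) % N                ∎
      where open ≡-Reasoning

    toℕ%N : (i : Fin N) → toℕ i % N ≡ toℕ i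
    toℕ%N i = m<n⇒m%n≡m (toℕ<n i)

  shift-0 : (i : Fin N) → shift i 0 ≡ i
  shift-0 i = toℕ-injective (trans (toℕ-shift i 0) (trans (cong (_% N) (+-identityʳ (toℕ i))) (toℕ%N i)))

  shift-+ : (i : Fin N) (a b : ℕ) → shift (shift i a) b ≡ shift i (a + b)
  shift-+ i a b = toℕ-injective (begin
    toℕ (shift (shift i a) b)   ≡⟨ toℕ-shift (shift i a) b ⟩
    (toℕ (shift i a) + b) % N   ≡⟨ cong (λ x → (x + b) % N) (toℕ-shift i a) ⟩
    ((toℕ i + a) % N + b) % N   ≡⟨ cong (_% N) (+-comm _ b) ⟩
    (b + (toℕ i + a) % N) % N   ≡⟨ %-absorbʳ b (toℕ i + a) ⟩
    (b + (toℕ i + a)) % N       ≡⟨ cong (_% N) (trans (+-comm b _) (+-assoc (toℕ i) a b)) ⟩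
    (toℕ i + (a + b)) % N       ≡⟨ toℕ-shift i (a + b) ⟨
    toℕ (shift i (a + b))       ∎)
    where open ≡-Reasoning

  shift-N : (i : Fin N) → shift i N ≡ i
  shift-N i = toℕ-injective (trans (toℕ-shift i N) (trans ([m+n]%n≡m%n (toℕ i) N) (toℕ%N i)))

  offset : Fin N → Fin N → ℕ
  offset g i = (toℕ i + (N ∸ toℕ g)) % N

  offset<N : ∀ g i → offset g i < N
  offset<N g i = m%n<n (toℕ i + (N ∸ toℕ g)) N

  private
    g+[N∸g] : (g : Fin N) → toℕ g + (N ∸ toℕ g) ≡ N
    g+[N∸g] g = m+[n∸m]≡n (<⇒≤ (toℕ<n g))

    around : ∀ (g : Fin N) a → (toℕ g + a + (N ∸ toℕ g)) % N ≡ a % N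
    around g a = begin
      (toℕ g + a + (N ∸ toℕ g)) % N     ≡⟨ cong (λ x → (x + (N ∸ toℕ g)) % N) (+-comm (toℕ g) a) ⟩
      (a + toℕ g + (N ∸ toℕ g)) % N     ≡⟨ cong (_% N) (+-assoc a (toℕ g) _) ⟩
      (a + (toℕ g + (N ∸ toℕ g))) % N   ≡⟨ cong (λ x → (a + x) % N) (g+[N∸g] g) ⟩
      (a + N) % N                       ≡⟨ [m+n]%n≡m%n a N ⟩
      a % N                             ∎
      where open ≡-Reasoning

  shift-offset : ∀ g i → shift g (offset g i) ≡ i
  shift-offset g i = toℕ-injective (begin
    toℕ (shift g (offset g i))                      ≡⟨ toℕ-shift g _ ⟩
    (toℕ g + (toℕ i + (N ∸ toℕ g)) % N) % N         ≡⟨ %-absorbʳ (toℕ g) _ ⟩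
    (toℕ g + (toℕ i + (N ∸ toℕ g))) % N             ≡⟨ cong (_% N) (+-assoc (toℕ g) (toℕ i) _) ⟨
    (toℕ g + toℕ i + (N ∸ toℕ g)) % N               ≡⟨ around g (toℕ i) ⟩
    toℕ i % N                                       ≡⟨ toℕ%N i ⟩
    toℕ i                                           ∎)
    where open ≡-Reasoning

  offset-shift : ∀ g {a} → a < N → offset g (shift g a) ≡ a
  offset-shift g {a} a<N = begin
    (toℕ (shift g a) + (N ∸ toℕ g)) % N             ≡⟨ cong (λ x → (x + (N ∸ toℕ g)) % N) (toℕ-shift g a) ⟩
    ((toℕ g + a) % N + (N ∸ toℕ g)) % N             ≡⟨ cong (_% N) (+-comm _ (N ∸ toℕ g)) ⟩
    ((N ∸ toℕ g) + (toℕ g + a) % N) % N             ≡⟨ %-absorbʳ (N ∸ toℕ g) _ ⟩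
    ((N ∸ toℕ g) + (toℕ g + a)) % N                 ≡⟨ cong (_% N) (+-comm (N ∸ toℕ g) _) ⟩
    (toℕ g + a + (N ∸ toℕ g)) % N                   ≡⟨ around g a ⟩
    a % N                                           ≡⟨ m<n⇒m%n≡m a<N ⟩
    a                                               ∎
    where open ≡-Reasoning

  shift-injective : ∀ i {a b} → a < N → b < N → shift i a ≡ shift i b → a ≡ b
  shift-injective i {a} {b} a<N b<N eq =
    trans (sym (offset-shift i a<N)) (trans (cong (offset i) eq) (offset-shift i b<N))

  shift≢ : ∀ i {a} → 0 < a → a < N → shift i a ≢ i
  shift≢ i {a} 0<a a<N eq = <-irrefl (sym a≡0) 0<a
    where
    a≡0 : a ≡ 0
    a≡0 = shift-injective i a<N (s≤s z≤n) (trans eq (sym (shift-0 i)))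

module _ {L : ℕ} (P : Fin (suc L) → Bool) where

  ChangesAt : Fin (suc L) → Set
  ChangesAt i = P i ≢ P (shift i 1)

  change-before : ∀ s r → P s ≢ P (shift s r) → ∃ λ t → t < r × ChangesAt (shift s t)
  change-before s zero    P≢ = contradiction (cong P (sym (shift-0 s))) P≢
  change-before s (suc r) P≢ with P s ≟ᵇ P (shift s r)
  ... | no P≢′ with change-before s r P≢′
  ...   | t , t<r , changes = t , ≤-trans t<r (n≤1+n r) , changes
  change-before s (suc r) P≢ | yes P≡ = r , ≤-refl , λ same →
    P≢ (trans P≡ (trans same (cong P (trans (shift-+ s r 1) (cong (shift s) (+-comm r 1))))))

  change-exists : ∀ a b → P a ≢ P b → ∃ ChangesAt
  change-exists a b P≢ with change-before a (offset a b) (λ eq → P≢ (trans eq (cong P (shift-offset a b))))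
  ... | t , _ , changes = shift a t , changes

  another-change : ∀ i → ChangesAt i → ∃ λ j → j ≢ i × ChangesAt j
  another-change i changes with change-before (shift i 1) L back
    where
    back : P (shift i 1) ≢ P (shift (shift i 1) L)
    back eq = changes (sym (trans eq (cong P (trans (shift-+ i 1 L) (shift-N i)))))
  ... | t , t<L , changes′ =
    shift (shift i 1) t , (λ eq → shift≢ i (s≤s z≤n) (s≤s t<L) (trans (sym (shift-+ i 1 t)) eq)) , changes′

module _ {k : ℕ} where

  next : Fin (3 + k) → Fin (3 + k)
  next i = shift i 1

  prev : Fin (3 + k) → Fin (3 + k)
  prev i = shift i (2 + k)

  next-prev : ∀ i → next (prev i) ≡ i
  next-prev i = trans (shift-+ i (2 + k) 1) (trans (cong (shift i) (+-comm (2 + k) 1)) (shift-N i))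

  prev-next : ∀ i → prev (next i) ≡ i
  prev-next i = trans (shift-+ i 1 (2 + k)) (shift-N i)

  next≢ : ∀ i → next i ≢ i
  next≢ i = shift≢ i (s≤s z≤n) (s≤s (s≤s z≤n))

  prev≢ : ∀ i → prev i ≢ i
  prev≢ i = shift≢ i (s≤s z≤n) ≤-refl

  next²≢ : ∀ i → next (next i) ≢ i
  next²≢ i eq = shift≢ i (s≤s z≤n) (s≤s (s≤s (s≤s z≤n))) (trans (sym (shift-+ i 1 1)) eq)

  prev≢next : ∀ i → prev i ≢ next i
  prev≢next i eq = next²≢ (prev i) (trans (cong next (next-prev i)) (sym eq))

shift-fromℕ : ∀ L → shift (fromℕ L) 1 ≡ zero
shift-fromℕ L = toℕ-injective (begin
  toℕ (shift (fromℕ L) 1)  ≡⟨ toℕ-shift (fromℕ L) 1 ⟩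
  (toℕ (fromℕ L) + 1) % suc L ≡⟨ cong (λ x → (x + 1) % suc L) (toℕ-fromℕ L) ⟩
  (L + 1) % suc L         ≡⟨ cong (_% suc L) (+-comm L 1) ⟩
  suc L % suc L           ≡⟨ n%n≡0 (suc L) ⟩
  0                       ∎)
  where open ≡-Reasoning

shift-inject₁ : ∀ {L} (j : Fin L) → shift (inject₁ j) 1 ≡ suc j
shift-inject₁ {L} j = toℕ-injective (begin
  toℕ (shift (inject₁ j) 1)        ≡⟨ toℕ-shift (inject₁ j) 1 ⟩
  (toℕ (inject₁ j) + 1) % suc L    ≡⟨ cong (λ x → (x + 1) % suc L) (toℕ-inject₁ j) ⟩
  (toℕ j + 1) % suc L              ≡⟨ cong (_% suc L) (+-comm (toℕ j) 1) ⟩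
  suc (toℕ j) % suc L              ≡⟨ m<n⇒m%n≡m (s≤s (toℕ<n j)) ⟩
  suc (toℕ j)                      ∎)
  where open ≡-Reasoning

avoid-two : ∀ {k} (b₁ b₂ : Fin (3 + k)) → ∃ λ i → i ≢ b₁ × i ≢ b₂
avoid-two zero          zero          = suc zero       , (λ ()) , (λ ())
avoid-two zero          (suc zero)    = suc (suc zero) , (λ ()) , (λ ())
avoid-two zero          (suc (suc _)) = suc zero       , (λ ()) , (λ ())
avoid-two (suc zero)    zero          = suc (suc zero) , (λ ()) , (λ ())
avoid-two (suc (suc _)) zero          = suc zero       , (λ ()) , (λ ())
avoid-two (suc _)       (suc _)       = zero           , (λ ()) , (λ ())

-- Walks, simple paths and cycles

module _ (H : Multigraph) where

  private
    V = Fin (n H)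
    E = Fin (m H)

  Joins-ends : ∀ e → Joins H e (proj₁ (ends H e)) (proj₂ (ends H e))
  Joins-ends e = inj₁ refl

  Joins-sym : ∀ {e u v} → Joins H e u v → Joins H e v u
  Joins-sym (inj₁ eq) = inj₂ eq
  Joins-sym (inj₂ eq) = inj₁ eq

  Joins-unique : ∀ {e x y x′ y′} → Joins H e x y → Joins H e x′ y′ →
                 (x ≡ x′ × y ≡ y′) ⊎ (x ≡ y′ × y ≡ x′)
  Joins-unique (inj₁ refl) (inj₁ eq) = inj₁ (cong proj₁ eq , cong proj₂ eq)
  Joins-unique (inj₁ refl) (inj₂ eq) = inj₂ (cong proj₁ eq , cong proj₂ eq)
  Joins-unique (inj₂ refl) (inj₁ eq) = inj₂ (cong proj₂ eq , cong proj₁ eq)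
  Joins-unique (inj₂ refl) (inj₂ eq) = inj₁ (cong proj₂ eq , cong proj₁ eq)

  Joins⇒Incident : ∀ {e u v} → Joins H e u v → Incident H e v
  Joins⇒Incident (inj₁ refl) = inj₂ refl
  Joins⇒Incident (inj₂ refl) = inj₁ refl

  joins? : ∀ e u v → Dec (Joins H e u v)
  joins? e u v = (ends H e ≟ₑ (u , v)) ⊎-dec (ends H e ≟ₑ (v , u))
    where _≟ₑ_ = ≡-dec _≟_ _≟_

  cross-Joins : ∀ (P : VSet H) {e u v} → Joins H e u v → cross H P e ≡ P u xor P v
  cross-Joins P (inj₁ refl) = refl
  cross-Joins P {u = u} {v} (inj₂ refl) = xor-comm (P v) (P u)

  cycle-recrosses : ∀ (X : VSet H) (D : Cycle H) {i} → cross H X (Cycle.links D i) ≡ true →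
                    ∃ λ j → j ≢ i × cross H X (Cycle.links D j) ≡ true
  cycle-recrosses X D {i} crosses =
    let (j , j≢i , changes) = another-change (X ∘ Cycle.nodes D) i (xor≡true⇒≢ (trans (sym (cross-Joins X (joins i))) crosses))
    in j , j≢i , trans (cross-Joins X (joins j)) (≢⇒xor≡true changes)
    where joins = proj₂ (proj₂ (Cycle.isCycle D))

module _ {H : Multigraph} where

  private
    V = Fin (n H)
    E = Fin (m H)
  module _ {S : ESet H} where

    _++_ : ∀ {u v w} → Reach H S u v → Reach H S v w → Reach H S u w
    here           ++ q = q
    step e s j p   ++ q = step e s j (p ++ q)

    snoc : ∀ {u v w} e → S e ≡ true → Joins H e v w → Reach H S u v → Reach H S u w
    snoc e s j p = p ++ step e s j here

    reverse : ∀ {u v} → Reach H S u v → Reach H S v u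
    reverse here           = here
    reverse (step e s j p) = snoc e s (Joins-sym H j) (reverse p)

  Reach-mono : ∀ {S S′ : ESet H} → S ⊆ S′ → ∀ {u v} → Reach H S u v → Reach H S′ u v
  Reach-mono S⊆S′ here           = here
  Reach-mono S⊆S′ (step e s j p) = step e (S⊆S′ e s) j (Reach-mono S⊆S′ p)

  module _ {S : ESet H} where

    data Visits (x : V) : ∀ {u w} → Reach H S u w → Set where
      start : ∀ {w} {p : Reach H S x w} → Visits x p
      later : ∀ {u v w e s j} {p : Reach H S v w} → Visits x p → Visits x (step {u = u} e s j p)

    visits? : ∀ x {u w} (p : Reach H S u w) → Dec (Visits x p)
    visits? x (here {u}) with x ≟ u
    ... | yes refl = yes start
    ... | no x≢u   = no λ { start → x≢u refl }
    visits? x (step {u} e s j p) with x ≟ u | visits? x p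
    ... | yes refl | _       = yes start
    ... | no x≢u   | yes vis = yes (later vis)
    ... | no x≢u   | no ¬vis = no λ { start → x≢u refl ; (later vis) → ¬vis vis }

    Simple : ∀ {u w} → Reach H S u w → Set
    Simple here               = ⊤
    Simple (step {u} e s j p) = ¬ Visits u p × Simple p

    suffix : ∀ {x u w} (p : Reach H S u w) → Visits x p → Σ (Reach H S x w) λ q → (Simple p → Simple q)
    suffix p                start     = p , λ simple → simple
    suffix (step e s j p)   (later v) with suffix p v
    ... | q , simple-q = q , simple-q ∘ proj₂

    erase : ∀ {u w} → Reach H S u w → Σ (Reach H S u w) Simple
    erase here = here , tt
    erase (step {u} e s j p) with erase p
    ... | q , simple-q with visits? u q
    ...   | yes vis = proj₁ (suffix q vis) , proj₂ (suffix q vis) simple-q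
    ...   | no ¬vis = step e s j q , ¬vis , simple-q

    length : ∀ {u w} → Reach H S u w → ℕ
    length here           = 0
    length (step e s j p) = suc (length p)

    nodeAt : ∀ {u w} (p : Reach H S u w) → Fin (suc (length p)) → V
    nodeAt (here {u})          zero    = u
    nodeAt (step {u} e s j p)  zero    = u
    nodeAt (step e s j p)      (suc i) = nodeAt p i

    edgeAt : ∀ {u w} (p : Reach H S u w) → Fin (length p) → E
    edgeAt (step e s j p) zero    = e
    edgeAt (step e s j p) (suc i) = edgeAt p i

    nodeAt-first : ∀ {u w} (p : Reach H S u w) → nodeAt p zero ≡ u
    nodeAt-first here           = refl
    nodeAt-first (step e s j p) = refl

    nodeAt-last : ∀ {u w} (p : Reach H S u w) → nodeAt p (fromℕ (length p)) ≡ w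
    nodeAt-last here           = refl
    nodeAt-last (step e s j p) = nodeAt-last p

    edgeAt∈S : ∀ {u w} (p : Reach H S u w) i → S (edgeAt p i) ≡ true
    edgeAt∈S (step e s j p) zero    = s
    edgeAt∈S (step e s j p) (suc i) = edgeAt∈S p i

    edgeAt-joins : ∀ {u w} (p : Reach H S u w) i → Joins H (edgeAt p i) (nodeAt p (inject₁ i)) (nodeAt p (suc i))
    edgeAt-joins (step e s j p) zero    = subst (Joins H e _) (sym (nodeAt-first p)) j
    edgeAt-joins (step e s j p) (suc i) = edgeAt-joins p i

    nodeAt-visits : ∀ {u w} (p : Reach H S u w) i → Visits (nodeAt p i) p
    nodeAt-visits here           zero    = start
    nodeAt-visits (step e s j p) zero    = start
    nodeAt-visits (step e s j p) (suc i) = later (nodeAt-visits p i)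

    nodeAt-injective : ∀ {u w} (p : Reach H S u w) → Simple p → ∀ {i i′} → nodeAt p i ≡ nodeAt p i′ → i ≡ i′
    nodeAt-injective here           _                {zero}  {zero}   _  = refl
    nodeAt-injective (step e s j p) _                {zero}  {zero}   _  = refl
    nodeAt-injective (step e s j p) (¬vis , _)       {zero}  {suc i′} eq =
      contradiction (subst (λ x → Visits x p) (sym eq) (nodeAt-visits p i′)) ¬vis
    nodeAt-injective (step e s j p) (¬vis , _)       {suc i} {zero}   eq =
      contradiction (subst (λ x → Visits x p) eq (nodeAt-visits p i)) ¬vis
    nodeAt-injective (step e s j p) (_ , simple)     {suc i} {suc i′} eq = cong suc (nodeAt-injective p simple eq)

    edgeAt-injective : ∀ {u w} (p : Reach H S u w) → Simple p → ∀ {i i′} → edgeAt p i ≡ edgeAt p i′ → i ≡ i′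
    edgeAt-injective p simple {i} {i′} eq
      with Joins-unique H (edgeAt-joins p i) (subst (λ e → Joins H e _ _) (sym eq) (edgeAt-joins p i′))
    ... | inj₁ (same , _) = inject₁-injective (nodeAt-injective p simple same)
    ... | inj₂ (crossed₁ , crossed₂) = contradiction (s≤s (n≤1+n (toℕ i′))) (<-irrefl (sym 2+i′≡i′))
      where
      i≡1+i′ : toℕ i ≡ suc (toℕ i′)
      i≡1+i′ = trans (sym (toℕ-inject₁ i)) (cong toℕ (nodeAt-injective p simple crossed₁))
      2+i′≡i′ : suc (suc (toℕ i′)) ≡ toℕ i′
      2+i′≡i′ = trans (cong suc (sym i≡1+i′)) (trans (cong toℕ (nodeAt-injective p simple crossed₂)) (toℕ-inject₁ i′))

    Simple⇒length< : ∀ {u w} (p : Reach H S u w) → Simple p → length p < n H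
    Simple⇒length< p simple = injective⇒≤ (nodeAt-injective p simple)

    avoid : ∀ {x y v w f} (p : Reach H S v w) → ¬ Visits x p → Joins H f x y →
            Reach H (λ g → S g ∧ not ⌊ g ≟ f ⌋) v w
    avoid here _ _ = here
    avoid {f = f} (step e s j p) ¬vis j-f with e ≟ f
    ... | no e≢f = step e kept j (avoid p (¬vis ∘ later) j-f)
      where
      kept : S e ∧ not ⌊ e ≟ f ⌋ ≡ true
      kept = cong₂ (λ a b → a ∧ not b) s (⌊⌋-false (_ ≟ _) e≢f)
    ... | yes refl with Joins-unique H j-f j
    ...   | inj₁ (refl , _) = contradiction start ¬vis
    ...   | inj₂ (refl , _) = contradiction (later (subst (λ z → Visits z p) (nodeAt-first p) (nodeAt-visits p zero))) ¬vis

module _ (H : Multigraph) where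

  private
    V = Fin (n H)
    E = Fin (m H)

  module _ {S : ESet H} (P : VSet H) where

    Uncrossed-reach : (∀ e → S e ≡ true → cross H P e ≡ false) → ∀ {u w} → Reach H S u w → P u ≡ P w
    Uncrossed-reach uncrossed here = refl
    Uncrossed-reach uncrossed (step {u} {v} e s j p) =
      trans (xor≡false⇒≡ (trans (sym (cross-Joins H P j)) (uncrossed e s))) (Uncrossed-reach uncrossed p)

    record Exit (u : V) : Set where
      field
        {inner outer} : V
        edge       : E
        edge∈S     : S edge ≡ true
        joins      : Joins H edge inner outer
        inner∈P    : P inner ≡ true
        outer∉P    : P outer ≡ false
        path       : Reach H S u inner

    exit : ∀ {u w} → Reach H S u w → P u ≡ true → P w ≡ false → Exit u
    exit here Pu Pw = contradiction (trans (sym Pu) Pw) λ ()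
    exit (step {u} {v} e s j p) Pu Pw with P v in Pv
    ... | false = record { edge = e ; edge∈S = s ; joins = j ; inner∈P = Pu ; outer∉P = Pv ; path = here }
    ... | true  = prepend (exit p Pv Pw)
      where
      prepend : Exit v → Exit u
      prepend ε = record { Exit ε ; path = step e s j (Exit.path ε) }

  module _ (S : ESet H) where

    private
      Short : ℕ → V → V → Set
      Short t u v = Σ (Reach H S u v) λ p → length p ≤ t

      short? : ∀ t u v → Dec (Short t u v)
      short? t u v with u ≟ v
      ... | yes refl = yes (here , z≤n)
      short? zero    u v | no u≢v = no λ { (here , _) → u≢v refl ; (step _ _ _ _ , ()) }
      short? (suc t) u v | no u≢v
        with any? (λ e → any? (λ y → (S e ≟ᵇ true) ×-dec joins? H e u y ×-dec short? t y v))
      ... | yes (e , y , s , j , p , p≤t) = yes (step e s j p , s≤s p≤t)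
      ... | no ¬first = no λ
        { (here , _) → u≢v refl
        ; (step e s j p , s≤s p≤t) → ¬first (e , _ , s , j , p , p≤t) }

    reach? : ∀ u v → Dec (Reach H S u v)
    reach? u v = map′ proj₁ shorten (short? (n H) u v)
      where
      shorten : Reach H S u v → Short (n H) u v
      shorten p = let (q , simple) = erase p in q , ≤-trans (n≤1+n _) (Simple⇒length< q simple)

  close-cycle : ∀ {S : ESet H} {e u v} → S e ≡ false → Joins H e u v → Reach H S v u →
                Σ (Cycle H) λ D → OnCycle H D e × (∀ i → S (Cycle.links D i) ≡ true ⊎ Cycle.links D i ≡ e)
  close-cycle {S} {e} {u} {v} e∉S e-joins path = D , (fromℕ L , links-last) , links∈S⊎e
    where
    p = proj₁ (erase path)
    simple = proj₂ (erase path)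
    L = length p

    nodes : Fin (suc L) → V
    nodes = nodeAt p

    links : Fin (suc L) → E
    links i with view i
    ... | ‵fromℕ      = e
    ... | ‵inject₁ j  = edgeAt p j

    links-last : links (fromℕ L) ≡ e
    links-last rewrite view-fromℕ L = refl

    links∈S⊎e : ∀ i → S (links i) ≡ true ⊎ links i ≡ e
    links∈S⊎e i with view i
    ... | ‵fromℕ     = inj₂ refl
    ... | ‵inject₁ j = inj₁ (edgeAt∈S p j)

    edgeAt≢e : ∀ j → edgeAt p j ≢ e
    edgeAt≢e j eq = contradiction (trans (sym (edgeAt∈S p j)) (trans (cong S eq) e∉S)) λ ()

    links-injective : ∀ {a b} → links a ≡ links b → a ≡ b
    links-injective {a} {b} eq with view a | view b
    ... | ‵fromℕ     | ‵fromℕ     = refl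
    ... | ‵fromℕ     | ‵inject₁ j = contradiction (sym eq) (edgeAt≢e j)
    ... | ‵inject₁ i | ‵fromℕ     = contradiction eq (edgeAt≢e i)
    ... | ‵inject₁ i | ‵inject₁ j = cong inject₁ (edgeAt-injective p simple eq)

    links-joins : ∀ i → Joins H (links i) (nodes i) (nodes (shift i 1))
    links-joins i with view i
    ... | ‵fromℕ rewrite nodeAt-last p | shift-fromℕ L | nodeAt-first p = e-joins
    ... | ‵inject₁ j rewrite shift-inject₁ j = edgeAt-joins p j

    D : Cycle H
    D = record
      { k = L ; nodes = nodes ; links = links
      ; isCycle = nodeAt-injective p simple , links-injective , links-joins }

-- Fundamental cuts of a spanning tree

KEdgeConnected⇒K≤cut : ∀ {G K} → KEdgeConnected G K →
                       ∀ (X : VSet G) {v w} → X v ≡ true → X w ≡ false → K ≤ count (cross G X)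
KEdgeConnected⇒K≤cut {G} {K} kec X {v} {w} Xv Xw with K ≤? count (cross G X)
... | yes K≤cut = K≤cut
... | no K≰cut  = contradiction (trans (sym Xv) (trans (Uncrossed-reach G X uncrossed connected) Xw)) λ ()
  where
  small : count (cross G X) ≤ K ∸ 1
  small = subst (count (cross G X) ≤_) (pred[m∸n]≡m∸[1+n] K 0) (suc[m]≤n⇒m≤pred[n] (≰⇒> K≰cut))
  connected : Reach G (λ e → not (cross G X e)) v w
  connected = proj₂ kec (cross G X) small v w
  uncrossed : ∀ e → not (cross G X e) ≡ true → cross G X e ≡ false
  uncrossed e = not≡true⇒≡false

module SpanningTree {G : Multigraph} {T : ESet G} (tree : IsSpanningTree G T) where

  private
    V = Fin (n G)
    E = Fin (m G)

  T∖_ : E → ESet G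
  T∖ e = removeEdge G T e

  ∈T∖ : ∀ {e f} → T f ≡ true → f ≢ e → (T∖ e) f ≡ true
  ∈T∖ Tf f≢e = cong₂ (λ a b → a ∧ not b) Tf (⌊⌋-false (_ ≟ _) f≢e)

  T∖⊆T : ∀ {e f} → (T∖ e) f ≡ true → T f ≡ true
  T∖⊆T {e} {f} kept with T f
  ... | true = refl

  T∖-removes : ∀ {e f} → (T∖ e) f ≡ true → f ≢ e
  T∖-removes {e} {f} kept refl with T f | f ≟ f
  ... | true | yes _ = contradiction kept λ ()
  ... | true | no f≢f = f≢f refl

  opaque
    side : E → V → VSet G
    side e x z = ⌊ reach? G (T∖ e) x z ⌋

    side-sound : ∀ {e x z} → side e x z ≡ true → Reach G (T∖ e) x z
    side-sound {e} {x} {z} s with reach? G (T∖ e) x z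
    ... | yes r = r

    side-complete : ∀ {e x z} → Reach G (T∖ e) x z → side e x z ≡ true
    side-complete {e} {x} {z} r with reach? G (T∖ e) x z
    ... | yes _ = refl
    ... | no ¬r = contradiction r ¬r

  side-refl : ∀ e x → side e x x ≡ true
  side-refl e x = side-complete here

  side-sym : ∀ {e x z} → side e x z ≡ true → side e z x ≡ true
  side-sym = side-complete ∘ reverse ∘ side-sound

  side-trans : ∀ {e x y z} → side e x y ≡ true → side e y z ≡ true → side e x z ≡ true
  side-trans s₁ s₂ = side-complete (side-sound s₁ ++ side-sound s₂)

  side-step : ∀ {e f x z z′} → T f ≡ true → f ≢ e → Joins G f z z′ → side e x z ≡ true → side e x z′ ≡ true
  side-step Tf f≢e j s = side-complete (snoc _ (∈T∖ Tf f≢e) j (side-sound s))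

  side-cong : ∀ {e x y} → side e x y ≡ true → ∀ z → side e x z ≡ side e y z
  side-cong {e} {x} {y} sxy z with side e x z in sxz | side e y z in syz
  ... | true  | true  = refl
  ... | false | false = refl
  ... | true  | false = contradiction (trans (sym (side-trans (side-sym sxy) sxz)) syz) λ ()
  ... | false | true  = contradiction (trans (sym (side-trans sxy syz)) sxz) λ ()

  e∉T∖e : ∀ e → (T∖ e) e ≡ false
  e∉T∖e e = trans (cong (λ b → T e ∧ not b) (⌊⌋-complete (e ≟ e) refl)) (∧-zeroʳ (T e))

  side-separates : ∀ {e p q} → T e ≡ true → Joins G e p q → side e p q ≡ false
  side-separates {e} {p} {q} Te j with side e p q in spq
  ... | false = refl
  ... | true with close-cycle G (e∉T∖e e) (Joins-sym G j) (side-sound spq)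
  ...   | D , _ , links∈T∖⊎e = contradiction (D , links∈T) (proj₂ tree)
    where
    links∈T : ∀ i → T (Cycle.links D i) ≡ true
    links∈T i = [ T∖⊆T , (λ eq → trans (cong T eq) Te) ]′ (links∈T∖⊎e i)

  sides-cover : ∀ {e p q} → Joins G e p q → ∀ z → side e p z ≡ true ⊎ side e q z ≡ true
  sides-cover {e} {p} {q} j z = walk (proj₁ tree p z) (inj₁ (side-refl e p))
    where
    walk : ∀ {u w} → Reach G T u w → side e p u ≡ true ⊎ side e q u ≡ true → side e p w ≡ true ⊎ side e q w ≡ true
    walk here           near = near
    walk (step f Tf jf r) near with f ≟ e
    ... | no f≢e = walk r ([ inj₁ ∘ side-step Tf f≢e jf , inj₂ ∘ side-step Tf f≢e jf ]′ near)
    ... | yes refl with Joins-unique G jf j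
    ...   | inj₁ (_ , refl) = walk r (inj₂ (side-refl e q))
    ...   | inj₂ (_ , refl) = walk r (inj₁ (side-refl e p))

  opposite-sides : ∀ {e p q} → T e ≡ true → Joins G e p q → ∀ z → side e q z ≡ not (side e p z)
  opposite-sides {e} {p} {q} Te j z with sides-cover j z
  ... | inj₁ pz = trans (¬-not λ qz → separated (side-trans pz (side-sym qz))) (cong not (sym pz))
    where separated = λ s → not-¬ s (side-separates Te j)
  ... | inj₂ qz = trans qz (cong not (sym (¬-not λ pz → separated (side-trans pz (side-sym qz)))))
    where separated = λ s → not-¬ s (side-separates Te j)

  side-complement : ∀ {e x y} → T e ≡ true → side e x y ≡ false → ∀ z → side e y z ≡ not (side e x z)
  side-complement {e} {x} {y} Te sxy z with sides-cover j x | sides-cover j y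
    where j = Joins-ends G e
  ... | inj₁ px | inj₁ py = contradiction (trans (sym (side-trans (side-sym px) py)) sxy) λ ()
  ... | inj₂ qx | inj₂ qy = contradiction (trans (sym (side-trans (side-sym qx) qy)) sxy) λ ()
  ... | inj₁ px | inj₂ qy =
    trans (sym (side-cong qy z)) (trans (opposite-sides Te (Joins-ends G e) z) (cong not (side-cong px z)))
  ... | inj₂ qx | inj₁ py =
    trans (sym (side-cong py z)) (trans (opposite-sides Te (Joins-sym G (Joins-ends G e)) z) (cong not (side-cong qx z)))

  side-exit : ∀ {e f x z z′} → T f ≡ true → Joins G f z z′ → side e x z ≡ true → side e x z′ ≡ false → f ≡ e
  side-exit {e} {f} Tf j sz sz′ with f ≟ e
  ... | yes f≡e = f≡e
  ... | no f≢e  = contradiction (trans (sym (side-step Tf f≢e j sz)) sz′) λ ()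

  separating-edge : ∀ {x x′} → x ≢ x′ → ∃ λ e → T e ≡ true × side e x x′ ≡ false
  separating-edge {x} {x′} x≢x′ with erase (proj₁ tree x x′)
  ... | here , _ = contradiction refl x≢x′
  ... | step f Tf j rest , ¬x∈rest , _ =
    f , Tf , ¬-not λ sxx′ → not-¬ (side-trans sxx′ (side-sym (side-complete rest∖f))) (side-separates Tf j)
    where
    rest∖f : Reach G (T∖ f) _ x′
    rest∖f = avoid rest ¬x∈rest j

  record Ends (e : E) (x : V) : Set where
    field
      {near far} : V
      joins      : Joins G e near far
      near∈side  : side e x near ≡ true
      far∉side   : side e x far ≡ false

  ends-from : ∀ {e} x → T e ≡ true → Ends e x
  ends-from {e} x Te with sides-cover (Joins-ends G e) x
  ... | inj₁ px = record { joins = Joins-ends G e ; near∈side = side-sym px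
                         ; far∉side = ¬-not λ sxq → not-¬ (side-trans px sxq) (side-separates Te (Joins-ends G e)) }
  ... | inj₂ qx = record { joins = Joins-sym G (Joins-ends G e) ; near∈side = side-sym qx
                         ; far∉side = ¬-not λ sxp → not-¬ (side-trans qx sxp) (side-separates Te (Joins-sym G (Joins-ends G e))) }

  side-isComponent : ∀ e x → IsComponent G (T∖ e) (side e x)
  side-isComponent e x =
    (x , side-refl e x) ,
    (λ u v su sv → side-sound (side-trans (side-sym su) sv)) ,
    (λ u v su r → side-trans su (side-complete r))

  side-isKCut : ∀ {K} → KEdgeConnected G K → CongestionAtMost G T K →
                ∀ {e} x → T e ≡ true → IsKCut G K (side e x)
  side-isKCut kec congestion {e} x Te =
    (x , side-refl e x) , (far , far∉side) ,
    ≤-antisym (congestion e Te (side e x) (side-isComponent e x))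
              (KEdgeConnected⇒K≤cut kec (side e x) (side-refl e x) far∉side)
    where open Ends (ends-from x Te)

  side-⊆-side : ∀ {e e″ q} → (∀ y → Incident G e″ y → side e q y ≡ false) → side e q ⊆ side e″ q
  side-⊆-side {e} {e″} {q} e″-outside z sqz = side-complete (go (side-refl e q) (side-sound sqz))
    where
    go : ∀ {y z} → side e q y ≡ true → Reach G (T∖ e) y z → Reach G (T∖ e″) y z
    go sqy here = here
    go sqy (step f kept j r) = step f (∈T∖ (T∖⊆T kept) f≢e″) j (go (side-step (T∖⊆T kept) (T∖-removes kept) j sqy) r)
      where
      f≢e″ : f ≢ e″
      f≢e″ refl = not-¬ sqy (e″-outside _ (Joins⇒Incident G (Joins-sym G j)))

  side-crossing : ∀ {e f x z z′} → T f ≡ true → Joins G f z z′ → side e x z ≢ side e x z′ → f ≡ e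
  side-crossing {e} {x = x} {z} {z′} Tf j differ with side e x z in sz | side e x z′ in sz′
  ... | true  | false = side-exit Tf j sz sz′
  ... | false | true  = side-exit Tf (Joins-sym G j) sz′ sz
  ... | true  | true  = contradiction refl differ
  ... | false | false = contradiction refl differ

  tree-edge-unique : ∀ {e e′ x y} → T e ≡ true → T e′ ≡ true → Joins G e x y → Joins G e′ x y → e′ ≡ e
  tree-edge-unique {e} {e′} {x} Te Te′ j j′ with e′ ≟ e
  ... | yes eq = eq
  ... | no e′≢e = contradiction (side-step Te′ e′≢e j′ (side-refl e x)) (not-¬ (side-separates Te j))

-- The blocks cut out by a cycle of the cactus

data BlockShape {A B : Set} (block : A → B) (X : A → Bool) : Set where
  respects : (∀ x y → block x ≡ block y → X x ≡ X y) → BlockShape block X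
  inside   : ∀ b → (∀ x → X x ≡ true → block x ≡ b) → BlockShape block X
  outside  : ∀ b → (∀ x → X x ≡ false → block x ≡ b) → BlockShape block X

module CactusCycle (C : Multigraph) (isCactus : IsCactus C) (k : ℕ)
  (a : Fin (3 + k) → Fin (n C)) (c : Fin (3 + k) → Fin (m C)) (cyc : IsCycle C (2 + k) a c)
  (Q : Fin (3 + k) → VSet C)
  (Q-spec : ∀ i x → (Q i x ≡ true) ⇔
     Reach C (λ f → not ⌊ f ≟ c (shift i (2 + k)) ⌋ ∧ not ⌊ f ≟ c i ⌋) (a i) x) where

  private
    ℓ = 3 + k
    U = Fin (n C)

  Avoiding : Fin ℓ → ESet C
  Avoiding i f = not ⌊ f ≟ c (prev i) ⌋ ∧ not ⌊ f ≟ c i ⌋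

  c-injective : ∀ {i j} → c i ≡ c j → i ≡ j
  c-injective = proj₁ (proj₂ cyc)

  c-joins : ∀ i → Joins C (c i) (a i) (a (next i))
  c-joins = proj₂ (proj₂ cyc)

  the-cycle : Cycle C
  the-cycle = record { k = 2 + k ; nodes = a ; links = c ; isCycle = cyc }

  Q⇒reach : ∀ {i x} → Q i x ≡ true → Reach C (Avoiding i) (a i) x
  Q⇒reach {i} {x} = Equivalence.to (Q-spec i x)

  reach⇒Q : ∀ {i x} → Reach C (Avoiding i) (a i) x → Q i x ≡ true
  reach⇒Q {i} {x} = Equivalence.from (Q-spec i x)

  a∈Q : ∀ i → Q i (a i) ≡ true
  a∈Q i = reach⇒Q here

  Avoiding-intro : ∀ {i f} → f ≢ c (prev i) → f ≢ c i → Avoiding i f ≡ true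
  Avoiding-intro f≢₁ f≢₂ = cong₂ (λ x y → not x ∧ not y) (⌊⌋-false (_ ≟ _) f≢₁) (⌊⌋-false (_ ≟ _) f≢₂)

  Avoiding-prev : ∀ {i} → Avoiding i (c (prev i)) ≡ false
  Avoiding-prev {i} = cong (λ x → not x ∧ not ⌊ c (prev i) ≟ c i ⌋) (⌊⌋-complete (c (prev i) ≟ c (prev i)) refl)

  Avoiding-self : ∀ {i} → Avoiding i (c i) ≡ false
  Avoiding-self {i} = trans (cong (λ x → not ⌊ c i ≟ c (prev i) ⌋ ∧ not x) (⌊⌋-complete (c i ≟ c i) refl)) (∧-zeroʳ _)

  Q-closed : ∀ i {f y y′} → Avoiding i f ≡ true → Joins C f y y′ → Q i y ≡ true → Q i y′ ≡ true
  Q-closed i kept j Qy = reach⇒Q (snoc _ kept j (Q⇒reach Qy))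

  Q-same-across : ∀ i {f y y′} → Avoiding i f ≡ true → Joins C f y y′ → Q i y ≡ Q i y′
  Q-same-across i {y = y} {y′} kept j with Q i y in Qy | Q i y′ in Qy′
  ... | true  | true  = refl
  ... | false | false = refl
  ... | true  | false = contradiction (Q-closed i kept j Qy) (not-¬ Qy′)
  ... | false | true  = contradiction (Q-closed i kept (Joins-sym C j) Qy′) (not-¬ Qy)

  same-cycle : ∀ (D : Cycle C) i → OnCycle C D (c i) → SameCycle C the-cycle D
  same-cycle D i on-D = proj₂ (proj₂ isCactus (c i)) the-cycle D (i , refl) on-D

  -- A path from a i to a (next i) avoiding c (prev i) and c i would close a second cycle through c i.
  a-next∉Q : ∀ i → Q i (a (next i)) ≡ false
  a-next∉Q i = ¬-not λ a-next∈Q → impossible (close-cycle C Avoiding-self (Joins-sym C (c-joins i)) (Q⇒reach a-next∈Q))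
    where
    impossible : (Σ (Cycle C) λ D → OnCycle C D (c i) × (∀ t → Avoiding i (Cycle.links D t) ≡ true ⊎ Cycle.links D t ≡ c i)) → ⊥
    impossible (D , c∈D , rest) with Equivalence.to (same-cycle D i c∈D (c (prev i))) (prev i , refl)
    ... | t , links≡ with rest t
    ...   | inj₁ kept = not-¬ kept (trans (cong (Avoiding i) links≡) Avoiding-prev)
    ...   | inj₂ eq   = prev≢ i (c-injective (trans (sym links≡) eq))

  private
    a-shift∉Q : ∀ i t → suc t < ℓ → Q i (a (shift i (suc t))) ≡ false
    a-shift∉Q i zero    _     = a-next∉Q i
    a-shift∉Q i (suc t) t+2<ℓ =
      trans (sym (Q-same-across i (Avoiding-intro (≢prev ∘ c-injective) (≢self ∘ c-injective)) link))
            (a-shift∉Q i t (≤-trans (n≤1+n _) t+2<ℓ))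
      where
      link : Joins C (c (shift i (suc t))) (a (shift i (suc t))) (a (shift i (suc (suc t))))
      link = subst (λ j → Joins C (c (shift i (suc t))) (a (shift i (suc t))) (a j))
                   (trans (shift-+ i (suc t) 1) (cong (shift i) (+-comm (suc t) 1)))
                   (c-joins (shift i (suc t)))
      ≢prev : shift i (suc t) ≢ prev i
      ≢prev eq = <-irrefl (cong suc (shift-injective i (≤-trans (n≤1+n _) t+2<ℓ) ≤-refl eq)) t+2<ℓ
      ≢self : shift i (suc t) ≢ i
      ≢self = shift≢ i (s≤s z≤n) (≤-trans (n≤1+n _) t+2<ℓ)

  a∉Q : ∀ {i j} → j ≢ i → Q i (a j) ≡ false
  a∉Q {i} {j} j≢i with offset i j in off | shift-offset i j | offset<N i j
  ... | zero  | shift≡j | _   = contradiction (trans (sym shift≡j) (shift-0 i)) j≢i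
  ... | suc t | shift≡j | t<ℓ = subst (λ j → Q i (a j) ≡ false) shift≡j (a-shift∉Q i t t<ℓ)

  OffCycle : ESet C
  OffCycle f = not ⌊ any? (λ t → f ≟ c t) ⌋

  OffCycle-intro : ∀ {f} → (∀ t → f ≢ c t) → OffCycle f ≡ true
  OffCycle-intro {f} f≢c with any? (λ t → f ≟ c t)
  ... | yes (t , f≡c) = contradiction f≡c (f≢c t)
  ... | no _          = refl

  OffCycle-elim : ∀ {f} → OffCycle f ≡ true → ∀ t → f ≢ c t
  OffCycle-elim {f} off t f≡c with any? (λ t → f ≟ c t)
  ... | yes _  = contradiction off λ ()
  ... | no ¬on = ¬on (t , f≡c)

  OffCycle⊆Avoiding : ∀ i → OffCycle ⊆ Avoiding i
  OffCycle⊆Avoiding i f off = Avoiding-intro (OffCycle-elim off (prev i)) (OffCycle-elim off i)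

  reach-off⇒Q : ∀ {i x} → Reach C OffCycle (a i) x → Q i x ≡ true
  reach-off⇒Q {i} = reach⇒Q ∘ Reach-mono (OffCycle⊆Avoiding i)

  Q⇒reach-off : ∀ {i x} → Q i x ≡ true → Reach C OffCycle (a i) x
  Q⇒reach-off {i} Qx = go (a∈Q i) (Q⇒reach Qx)
    where
    go : ∀ {y x} → Q i y ≡ true → Reach C (Avoiding i) y x → Reach C OffCycle y x
    go Qy here = here
    go {y} Qy (step f kept j r) = step f (OffCycle-intro f≢c) j (go (Q-closed i kept j Qy) r)
      where
      f≢c : ∀ t → f ≢ c t
      f≢c t refl with Joins-unique C j (c-joins t)
      ... | inj₁ (refl , _) = not-¬ Qy (a∉Q λ t≡i → not-¬ kept (trans (cong (Avoiding i ∘ c) t≡i) Avoiding-self))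
      ... | inj₂ (refl , _) = not-¬ Qy (a∉Q λ next≡i → not-¬ kept
                                (trans (cong (Avoiding i ∘ c) (trans (sym (prev-next t)) (cong prev next≡i))) Avoiding-prev))

  Q-disjoint : ∀ {i j x} → Q i x ≡ true → Q j x ≡ true → i ≡ j
  Q-disjoint {i} {j} Qi Qj with j ≟ i
  ... | yes j≡i = sym j≡i
  ... | no j≢i  = contradiction (reach-off⇒Q (Q⇒reach-off Qi ++ reverse (Q⇒reach-off Qj))) (not-¬ (a∉Q j≢i))

  Q-cover : ∀ x → ∃ λ i → Q i x ≡ true
  Q-cover x with walk (proj₁ isCactus (a zero) x)
    where
    walk : ∀ {u x} → Reach C (allEdges C) u x → (∃ λ i → Q i x ≡ true) ⊎ Reach C OffCycle u x
    walk here = inj₂ here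
    walk (step f _ j r) with walk r | any? (λ t → f ≟ c t)
    ... | inj₁ found       | _               = inj₁ found
    ... | inj₂ off         | no ¬on          = inj₂ (step f (OffCycle-intro (λ t f≡c → ¬on (t , f≡c))) j off)
    ... | inj₂ off         | yes (t , refl)  with Joins-unique C j (c-joins t)
    ...   | inj₁ (_ , refl) = inj₁ (next t , reach-off⇒Q off)
    ...   | inj₂ (_ , refl) = inj₁ (t , reach-off⇒Q off)
  ... | inj₁ found = found
  ... | inj₂ off   = zero , reach-off⇒Q off

  block : U → Fin ℓ
  block x = proj₁ (Q-cover x)

  Q-block : ∀ x → Q (block x) x ≡ true
  Q-block x = proj₂ (Q-cover x)

  block-unique : ∀ {i x} → Q i x ≡ true → block x ≡ i
  block-unique Qx = Q-disjoint (Q-block _) Qx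

  OffCycle-same-block : ∀ {f y y′} → OffCycle f ≡ true → Joins C f y y′ → block y ≡ block y′
  OffCycle-same-block {y = y} off j = sym (block-unique (Q-closed (block y) (OffCycle⊆Avoiding _ _ off) j (Q-block y)))

  cross-c : ∀ (X : VSet C) t → cross C X (c t) ≡ X (a t) xor X (a (next t))
  cross-c X t = cross-Joins C X (c-joins t)

  Q-isTwoCut : ∀ i → IsTwoCut C (Q i)
  Q-isTwoCut i = pair⇒count≡2 (cross C (Q i)) (prev≢ i ∘ c-injective) crosses-prev crosses-self only
    where
    crosses-prev : cross C (Q i) (c (prev i)) ≡ true
    crosses-prev = trans (cross-c (Q i) (prev i))
                         (cong₂ _xor_ (a∉Q (prev≢ i)) (trans (cong (Q i ∘ a) (next-prev i)) (a∈Q i)))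
    crosses-self : cross C (Q i) (c i) ≡ true
    crosses-self = trans (cross-c (Q i) i) (cong₂ _xor_ (a∈Q i) (a-next∉Q i))
    only : ∀ f → cross C (Q i) f ≡ true → f ≡ c (prev i) ⊎ f ≡ c i
    only f crosses with f ≟ c (prev i) | f ≟ c i
    ... | yes f≡ | _      = inj₁ f≡
    ... | no _   | yes f≡ = inj₂ f≡
    ... | no f≢₁ | no f≢₂ = contradiction
      (trans (cross-Joins C (Q i) (Joins-ends C f)) (≡⇒xor≡false (Q-same-across i (Avoiding-intro f≢₁ f≢₂) (Joins-ends C f))))
      (not-¬ crosses)

  Q∪Q-next-isTwoCut : ∀ i → IsTwoCut C (λ x → Q i x ∨ Q (next i) x)
  Q∪Q-next-isTwoCut i = pair⇒count≡2 (cross C Pair) (prev≢next i ∘ c-injective) crosses-prev crosses-next only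
    where
    Pair : VSet C
    Pair x = Q i x ∨ Q (next i) x
    crosses-prev : cross C Pair (c (prev i)) ≡ true
    crosses-prev = trans (cross-c Pair (prev i))
      (cong₂ _xor_ (cong₂ _∨_ (a∉Q (prev≢ i)) (a∉Q (prev≢next i)))
                   (trans (cong (Pair ∘ a) (next-prev i)) (cong (_∨ Q (next i) (a i)) (a∈Q i))))
    crosses-next : cross C Pair (c (next i)) ≡ true
    crosses-next = trans (cross-c Pair (next i))
      (cong₂ _xor_ (trans (cong (Q i (a (next i)) ∨_) (a∈Q (next i))) (∨-zeroʳ _))
                   (cong₂ _∨_ (a∉Q (next²≢ i)) (a∉Q (next≢ (next i)))))
    only : ∀ f → cross C Pair f ≡ true → f ≡ c (prev i) ⊎ f ≡ c (next i)
    only f crosses with f ≟ c (prev i) | f ≟ c (next i) | f ≟ c i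
    ... | yes f≡ | _      | _      = inj₁ f≡
    ... | no _   | yes f≡ | _      = inj₂ f≡
    ... | no _   | no _   | yes refl = contradiction
      (trans (cross-c Pair i) (≡⇒xor≡false (trans (cong (_∨ Q (next i) (a i)) (a∈Q i))
                                                   (sym (trans (cong (Q i (a (next i)) ∨_) (a∈Q (next i))) (∨-zeroʳ _))))))
      (not-¬ crosses)
    ... | no f≢₁ | no f≢₃ | no f≢₂ = contradiction
      (trans (cross-Joins C Pair (Joins-ends C f))
             (≡⇒xor≡false (cong₂ _∨_ (Q-same-across i (Avoiding-intro f≢₁ f≢₂) (Joins-ends C f))
                                     (Q-same-across (next i) (Avoiding-intro (subst (f ≢_) (cong c (sym (prev-next i))) f≢₂) f≢₃) (Joins-ends C f)))))
      (not-¬ crosses)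

  private
    endpoint-block : ∀ {f y y′ z z′} → OffCycle f ≡ true → Joins C f y y′ → Joins C f z z′ → block y ≡ block z
    endpoint-block off j j′ with Joins-unique C j j′
    ... | inj₁ (refl , _) = refl
    ... | inj₂ (refl , _) = OffCycle-same-block off (Joins-sym C j′)

    avoids-the-cycle : ∀ (D : Cycle C) {f} → OnCycle C D f → OffCycle f ≡ true → ∀ l t → Cycle.links D l ≢ c t
    avoids-the-cycle D {f} on-D off l t eq with Equivalence.from (same-cycle D t (l , eq) f) on-D
    ... | t′ , c≡f = OffCycle-elim off t′ (sym c≡f)

    cycle-in-one-block : ∀ (D : Cycle C) {f} → OnCycle C D f → OffCycle f ≡ true →
                         ∀ i j → block (Cycle.nodes D j) ≡ block (Cycle.nodes D i)
    cycle-in-one-block D on-D off i j with block (Cycle.nodes D j) ≟ block (Cycle.nodes D i)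
    ... | yes same  = same
    ... | no differ = contradiction (change-exists P i j P≢) no-change
      where
      nd = Cycle.nodes D
      lk = Cycle.links D
      b = block (nd i)
      P : Fin (suc (Cycle.k D)) → Bool
      P j = Q b (nd j)
      P≢ : P i ≢ P j
      P≢ eq = differ (block-unique (trans (sym eq) (Q-block (nd i))))
      no-change : ¬ ∃ (ChangesAt P)
      no-change (l , changes) with lk l ≟ c (prev b) | lk l ≟ c b
      ... | yes eq | _      = avoids-the-cycle D on-D off l (prev b) eq
      ... | no _   | yes eq = avoids-the-cycle D on-D off l b eq
      ... | no ≢₁  | no ≢₂  = changes (Q-same-across b (Avoiding-intro ≢₁ ≢₂) (proj₂ (proj₂ (Cycle.isCycle D)) l))

    crossings-in-one-block : ∀ (X : VSet C) → IsTwoCut C X → (∀ t → cross C X (c t) ≡ false) →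
                             ∃ λ b → ∀ {f y y′} → cross C X f ≡ true → Joins C f y y′ → block y ≡ b
    crossings-in-one-block X two uncrossed with count≡2⇒∃pair (cross C X) two
    ... | f₁ , f₂ , f₁≢f₂ , cr₁ , cr₂ = block (proj₁ (ends C f₁)) , in-block
      where
      off : ∀ {f} → cross C X f ≡ true → OffCycle f ≡ true
      off {f} cr = OffCycle-intro λ t f≡c → not-¬ cr (trans (cong (cross C X) f≡c) (uncrossed t))
      only : ∀ f → cross C X f ≡ true → f ≡ f₁ ⊎ f ≡ f₂
      only = count≡2⇒pair (cross C X) f₁≢f₂ cr₁ cr₂ two
      D : Cycle C
      D = proj₁ (proj₁ (proj₂ isCactus f₁))
      on-D : OnCycle C D f₁
      on-D = proj₂ (proj₁ (proj₂ isCactus f₁))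
      nd = Cycle.nodes D
      lk = Cycle.links D
      joins-at : ∀ {i f} → lk i ≡ f → Joins C f (nd i) (nd (shift i 1))
      joins-at {i} refl = proj₂ (proj₂ (Cycle.isCycle D)) i
      i₁ = proj₁ on-D
      second = cycle-recrosses C X D (trans (cong (cross C X) (proj₂ on-D)) cr₁)
      i₂ = proj₁ second
      lk-i₂≡f₂ : lk i₂ ≡ f₂
      lk-i₂≡f₂ with only (lk i₂) (proj₂ (proj₂ second))
      ... | inj₁ ≡f₁ = contradiction (proj₁ (proj₂ (Cycle.isCycle D)) (trans ≡f₁ (sym (proj₂ on-D)))) (proj₁ (proj₂ second))
      ... | inj₂ ≡f₂ = ≡f₂
      f₂-block : block (proj₁ (ends C f₂)) ≡ block (proj₁ (ends C f₁))
      f₂-block = begin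
        block (proj₁ (ends C f₂)) ≡⟨ endpoint-block (off cr₂) (Joins-ends C f₂) (joins-at lk-i₂≡f₂) ⟩
        block (nd i₂)             ≡⟨ cycle-in-one-block D on-D (off cr₁) i₁ i₂ ⟩
        block (nd i₁)             ≡⟨ endpoint-block (off cr₁) (joins-at (proj₂ on-D)) (Joins-ends C f₁) ⟩
        block (proj₁ (ends C f₁)) ∎
        where open ≡-Reasoning
      in-block : ∀ {f y y′} → cross C X f ≡ true → Joins C f y y′ → block y ≡ block (proj₁ (ends C f₁))
      in-block {f} cr j with only f cr
      ... | inj₁ refl = endpoint-block (off cr) j (Joins-ends C f)
      ... | inj₂ refl = trans (endpoint-block (off cr) j (Joins-ends C f)) f₂-block

    outside-block : ∀ (X : VSet C) b → (∀ {f y y′} → cross C X f ≡ true → Joins C f y y′ → block y ≡ b) →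
                    (∀ j → X (a j) ≡ true) → ∀ x → X x ≡ false → block x ≡ b
    outside-block X b in-b a∈X x x∉X = trans (sym (block-unique (reach-off⇒Q path))) (in-b crosses joins)
      where
      open Exit (exit C X (Q⇒reach-off (Q-block x)) (a∈X (block x)) x∉X)
      crosses : cross C X edge ≡ true
      crosses = trans (cross-Joins C X joins) (≢⇒xor≡true λ eq → not-¬ (trans (sym eq) inner∈P) outer∉P)

    respects-when-cycle-crossed : ∀ (X : VSet C) → IsTwoCut C X → ∀ t → cross C X (c t) ≡ true →
                                  ∀ x y → block x ≡ block y → X x ≡ X y
    respects-when-cycle-crossed X two t crosses x y same-block =
      trans (sym (along x)) (trans (cong (X ∘ a) same-block) (along y))
      where
      second = cycle-recrosses C X the-cycle crosses
      t′ = proj₁ second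
      only : ∀ f → cross C X f ≡ true → f ≡ c t ⊎ f ≡ c t′
      only = count≡2⇒pair (cross C X) (λ eq → proj₁ (proj₂ second) (sym (c-injective eq))) crosses (proj₂ (proj₂ second)) two
      off-uncrossed : ∀ f → OffCycle f ≡ true → cross C X f ≡ false
      off-uncrossed f off = ¬-not λ cr → [ OffCycle-elim off t , OffCycle-elim off t′ ]′ (only f cr)
      along : ∀ x → X (a (block x)) ≡ X x
      along x = Uncrossed-reach C X off-uncrossed (Q⇒reach-off (Q-block x))

    uncrossed-cycle-shape : ∀ (X : VSet C) → IsTwoCut C X → (∀ t → cross C X (c t) ≡ false) → BlockShape block X
    uncrossed-cycle-shape X two uncrossed = by-side (X (a zero)) refl
      where
      b = proj₁ (crossings-in-one-block X two uncrossed)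
      in-b = proj₂ (crossings-in-one-block X two uncrossed)
      agree : ∀ j → X (a j) ≡ X (a zero)
      agree j with X (a j) ≟ᵇ X (a zero)
      ... | yes eq = eq
      ... | no ≢   = let (t , changes) = change-exists (X ∘ a) j zero ≢ in
                     contradiction (trans (cross-c X t) (≢⇒xor≡true changes)) (not-¬ (uncrossed t))
      cross-not : ∀ f → cross C (not ∘ X) f ≡ cross C X f
      cross-not f = xor-annihilates-not (X (proj₁ (ends C f))) (X (proj₂ (ends C f)))
      by-side : ∀ x₀ → X (a zero) ≡ x₀ → BlockShape block X
      by-side true  X₀ = outside b (outside-block X b in-b λ j → trans (agree j) X₀)
      by-side false X₀ = inside b λ x Xx → outside-block (not ∘ X) b (λ {f} cr → in-b (trans (sym (cross-not f)) cr))
                                                        (λ j → cong not (trans (agree j) X₀)) x (cong not Xx)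

  twoCut-shape : ∀ (X : VSet C) → IsTwoCut C X → BlockShape block X
  twoCut-shape X two with any? (λ t → cross C X (c t) ≟ᵇ true)
  ... | yes (t , crosses) = respects (respects-when-cycle-crossed X two t crosses)
  ... | no ¬crossed       = uncrossed-cycle-shape X two λ t → ¬-not λ cr → ¬crossed (t , cr)

-- Hidden sides and core vertices

module HiddenSides {G : Multigraph} {T : ESet G} (tree : IsSpanningTree G T)
  {b : ℕ} (block : Fin (n G) → Fin b)
  (shape : ∀ {e} x → T e ≡ true → BlockShape block (SpanningTree.side tree e x))
  (third : ∀ b₁ b₂ → ∃ λ v → block v ≢ b₁ × block v ≢ b₂) where

  open SpanningTree tree

  private
    V = Fin (n G)
    E = Fin (m G)

  Respects : VSet G → Set
  Respects S = ∀ v w → block v ≡ block w → S v ≡ S w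

  record Hidden (e : E) (x : V) : Set where
    field
      tree-edge    : T e ≡ true
      within       : ∀ z → side e x z ≡ true → block z ≡ block x
      {missed}     : V
      missed-block : block missed ≡ block x
      missed-side  : side e x missed ≡ false

  hidden? : ∀ e x → Dec (Hidden e x)
  hidden? e x = map′ (λ (Te , within , _ , missed-block , missed-side) → record
                       { tree-edge = Te ; within = within ; missed-block = missed-block ; missed-side = missed-side })
                     (λ H → let open Hidden H in tree-edge , within , missed , missed-block , missed-side)
    ((T e ≟ᵇ true) ×-dec all? (λ z → (side e x z ≟ᵇ true) →-dec (block z ≟ block x))
                   ×-dec any? (λ z → (block z ≟ block x) ×-dec (side e x z ≟ᵇ false)))

  Core : V → Set
  Core x = ∀ e → ¬ Hidden e x

  core? : ∀ x → Dec (Core x)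
  core? x = all? (λ e → ¬? (hidden? e x))

  Hidden⇒¬Respects : ∀ {e x} → Hidden e x → ¬ Respects (side e x)
  Hidden⇒¬Respects {e} {x} H resp = not-¬ (trans (sym (resp x missed (sym missed-block))) (side-refl e x)) missed-side
    where open Hidden H

  Respects-all-sides : ∀ {e x} → T e ≡ true → Respects (side e x) → ∀ y → Respects (side e y)
  Respects-all-sides {e} {x} Te resp y v w same with side e x y in sxy
  ... | true  = trans (sym (side-cong sxy v)) (trans (resp v w same) (side-cong sxy w))
  ... | false = trans (side-complement Te sxy v) (trans (cong not (resp v w same)) (sym (side-complement Te sxy w)))

  unhidden-inside⇒Respects : ∀ {e y} β → T e ≡ true → ¬ Hidden e y → (∀ z → side e y z ≡ true → block z ≡ β) →
                             Respects (side e y)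
  unhidden-inside⇒Respects {e} {y} β Te ¬H in-β v w same with block v ≟ β
  ... | yes v∈β = trans (all-in v v∈β) (sym (all-in w (trans (sym same) v∈β)))
    where
    y∈β : block y ≡ β
    y∈β = in-β y (side-refl e y)
    all-in : ∀ z → block z ≡ β → side e y z ≡ true
    all-in z z∈β = ¬-not λ syz → ¬H (record
      { tree-edge = Te ; within = λ z′ s → trans (in-β z′ s) (sym y∈β)
      ; missed-block = trans z∈β (sym y∈β) ; missed-side = syz })
  ... | no v∉β = trans (none v v∉β) (sym (none w (v∉β ∘ trans same)))
    where
    none : ∀ z → block z ≢ β → side e y z ≡ false
    none z z∉β = ¬-not (z∉β ∘ in-β z)

  unhidden-separated⇒Respects : ∀ {e x x′} → T e ≡ true → ¬ Hidden e x → ¬ Hidden e x′ → side e x x′ ≡ false →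
                                Respects (side e x)
  unhidden-separated⇒Respects {e} {x} {x′} Te ¬H ¬H′ sxx′ with shape x Te
  ... | respects r  = r
  ... | inside β h  = unhidden-inside⇒Respects β Te ¬H h
  ... | outside β h = Respects-all-sides Te (unhidden-inside⇒Respects β Te ¬H′ h′) x
    where
    h′ : ∀ z → side e x′ z ≡ true → block z ≡ β
    h′ z s = h z (trans (sym (not-involutive _)) (cong not (trans (sym (side-complement Te sxx′ z)) s)))

  Core-unique : ∀ {x x′} → Core x → Core x′ → block x ≡ block x′ → x ≡ x′
  Core-unique {x} {x′} core core′ same with x ≟ x′
  ... | yes eq = eq
  ... | no x≢x′ with separating-edge x≢x′
  ...   | e , Te , sxx′ = contradiction
    (trans (sym (unhidden-separated⇒Respects Te (core e) (core′ e) sxx′ x x′ same)) (side-refl e x))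
    (not-¬ sxx′)

  not-both-hidden : ∀ {e x y} → Hidden e x → Hidden e y → side e x y ≡ false → ⊥
  not-both-hidden {e} {x} {y} Hx Hy sxy with third (block x) (block y)
  ... | v , v∉x , v∉y with side e x v in sxv
  ...   | true  = v∉x (Hidden.within Hx v sxv)
  ...   | false = v∉y (Hidden.within Hy v (trans (side-complement (Hidden.tree-edge Hx) sxy v) (cong not sxv)))

  Hidden-move : ∀ {e x y} → Hidden e y → side e y x ≡ true → Hidden e x
  Hidden-move {e} {x} {y} H syx = record
    { tree-edge    = tree-edge
    ; within       = λ z sxz → trans (within z (trans (side-cong syx z) sxz)) (sym x∈y)
    ; missed-block = trans missed-block (sym x∈y)
    ; missed-side  = trans (sym (side-cong syx missed)) missed-side }
    where
    open Hidden H
    x∈y : block x ≡ block y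
    x∈y = within x syx

  -- Sides of distinct tree edges are nested, disjoint or co-disjoint (side-⊆-side). Co-disjoint
  -- sides would leave no room for a third block, so side e x lies inside the side of e″ at far.
  Hidden-nest : ∀ {e x} (H : Hidden e x) (ε : Ends e x) → ∀ {e″} → Hidden e″ (Ends.far ε) →
                side e″ (Ends.far ε) x ≡ true
  Hidden-nest {e} {x} H ε {e″} H″ = nest
    where
    open Ends ε
    Te = Hidden.tree-edge H
    far-x : side e far x ≡ false
    far-x = ¬-not λ s → not-¬ (side-sym s) far∉side
    nest : side e″ far x ≡ true
    nest with e″ ≟ e
    ... | yes refl = ⊥-elim (not-both-hidden H H″ far∉side)
    ... | no e″≢e with side e far (proj₁ (ends G e″)) in s₁ | side e far (proj₂ (ends G e″)) in s₂
    ...   | true  | false = ⊥-elim (not-¬ (side-step (Hidden.tree-edge H″) e″≢e (Joins-ends G e″) s₁) s₂)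
    ...   | false | true  = ⊥-elim (not-¬ (side-step (Hidden.tree-edge H″) e″≢e (Joins-sym G (Joins-ends G e″)) s₂) s₁)
    ...   | true  | true  = side-trans near∈far″ (side-sym (side-⊆-side avoids-x near near∈side))
      where
      near∈far″ : side e″ far near ≡ true
      near∈far″ = side-step Te (e″≢e ∘ sym) (Joins-sym G joins) (side-refl e″ far)
      avoids-x : ∀ y → Incident G e″ y → side e x y ≡ false
      avoids-x y (inj₁ refl) = trans (side-complement Te far-x y) (cong not s₁)
      avoids-x y (inj₂ refl) = trans (side-complement Te far-x y) (cong not s₂)
    ...   | false | false with third (block x) (block far)
    ...     | v , v∉x , v∉far = ⊥-elim (v∉far (Hidden.within H″ v (side-⊆-side avoids-far v v∈far)))
      where
      avoids-far : ∀ y → Incident G e″ y → side e far y ≡ false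
      avoids-far y (inj₁ refl) = s₁
      avoids-far y (inj₂ refl) = s₂
      v∈far : side e far v ≡ true
      v∈far = trans (side-complement Te far∉side v) (cong not (¬-not (v∉x ∘ Hidden.within H v)))

  Ends-move : ∀ {e x y} → Ends e y → side e y x ≡ true → Ends e x
  Ends-move ε syx = record
    { joins = joins
    ; near∈side = trans (sym (side-cong syx near)) near∈side
    ; far∉side = trans (sym (side-cong syx far)) far∉side }
    where open Ends ε

  record Hanging (x : V) : Set where
    field
      edge     : E
      hidden   : Hidden edge x
      endpoints : Ends edge x
      far-core  : Core (Ends.far endpoints)

  private
    hidden-at : V → ESet G
    hidden-at x e = ⌊ hidden? e x ⌋

    some-hidden : ∀ {x} → ¬ Core x → ∃ λ e → Hidden e x
    some-hidden {x} ¬core with ¬∀⟶∃¬ (m G) (λ e → ¬ Hidden e x) (λ e → ¬? (hidden? e x)) ¬core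
    ... | e , ¬¬H = e , decidable-stable (hidden? e x) ¬¬H

    -- Induction on the number of tree edges hiding x: the far end of a hiding edge is hidden
    -- by strictly fewer edges.
    hang-within : ∀ N x → count (hidden-at x) ≤ N → ¬ Core x → Hanging x
    hang-within zero x bound ¬core with some-hidden ¬core
    ... | e , H = contradiction (≤-trans (∈⇒count>0 (hidden-at x) (⌊⌋-complete (hidden? e x) H)) bound) λ ()
    hang-within (suc N) x bound ¬core = let (_ , H) = some-hidden ¬core in hang-from H (ends-from x (Hidden.tree-edge H))
      where
      hang-from : ∀ {e} → Hidden e x → Ends e x → Hanging x
      hang-from {e} H ε with core? (Ends.far ε)
      ... | yes far-core = record { hidden = H ; endpoints = ε ; far-core = far-core }
      ... | no ¬far-core = lift (hang-within N far fewer ¬far-core)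
        where
        open Ends ε
        inherited : hidden-at far ⊆ hidden-at x
        inherited e″ h = ⌊⌋-complete (hidden? e″ x) (Hidden-move H″ (Hidden-nest H ε H″))
          where H″ = ⌊⌋-sound (hidden? e″ far) h
        fewer : count (hidden-at far) ≤ N
        fewer = ≤-pred (≤-trans (count-< inherited (⌊⌋-false (hidden? e far) λ H′ → not-both-hidden H H′ far∉side)
                                                      (⌊⌋-complete (hidden? e x) H)) bound)
        lift : Hanging far → Hanging x
        lift h = record { hidden = Hidden-move hidden far-x ; endpoints = Ends-move endpoints far-x ; far-core = far-core }
          where
          open Hanging h
          far-x = Hidden-nest H ε hidden

  hang : ∀ {x} → ¬ Core x → Hanging x
  hang {x} = hang-within (m G) x (count≤ (hidden-at x))

  Core-exists : V → ∃ Core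
  Core-exists v with core? v
  ... | yes core = v , core
  ... | no ¬core = let open Hanging (hang ¬core) in Ends.far endpoints , far-core

  hanging-edge : ∀ {f t s} → T f ≡ true → Joins G f t s → block t ≢ block s → ¬ Core t → Core s × Hidden f t
  hanging-edge {f} {t} {s} Tf j t≢s ¬core with hang ¬core
  ... | record { edge = e ; hidden = H ; endpoints = ε ; far-core = far-core } with side-exit Tf j (side-refl e t) s∉side
    where
    s∉side : side e t s ≡ false
    s∉side = ¬-not λ s∈side → t≢s (sym (Hidden.within H s s∈side))
  ...   | refl with Joins-unique G j (Ends.joins ε)
  ...     | inj₁ (refl , refl) = far-core , H
  ...     | inj₂ (refl , refl) = ⊥-elim (not-¬ (side-refl f t) (Ends.far∉side ε))

  separator-respects : ∀ {h r r′} → Core r → Core r′ → T h ≡ true → side h r r′ ≡ false → Respects (side h r)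
  separator-respects core core′ Th shr′ = unhidden-separated⇒Respects Th (core _) (core′ _) shr′

  separator-hides-nothing : ∀ {h r r′ u} → Core r → Core r′ → side h r r′ ≡ false → ¬ Hidden h u
  separator-hides-nothing {u = u} core core′ shr′ H =
    Hidden⇒¬Respects H (Respects-all-sides tree-edge (separator-respects core core′ tree-edge shr′) u)
    where open Hidden H

  no-core-beside : ∀ {f u v r} → T f ≡ true → Joins G f u v → block u ≢ block v → ¬ Core u →
                   Core r → block r ≡ block u → ⊥
  no-core-beside {f} {u} {v} {r} Tf j u≢v ¬core-u core-r r∈u with hanging-edge Tf j u≢v ¬core-u
  ... | core-v , Hf with separating-edge {r} {v} (λ r≡v → u≢v (trans (sym r∈u) (cong block r≡v)))
  ...   | h , Th , shv = not-¬ (side-step Tf f≢h j shu) shv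
    where
    f≢h : f ≢ h
    f≢h refl = separator-hides-nothing core-r core-v shv Hf
    shu : side h r u ≡ true
    shu = trans (separator-respects core-r core-v Th shv u r (sym r∈u)) (side-refl h r)

  hangs-from-two-cores : ∀ {f₁ f₂ s t t′ y} → Core s → Core y → s ≢ y →
                         Joins G f₁ s t → Hidden f₁ t → Joins G f₂ t′ y → Hidden f₂ t′ → block t ≡ block t′ → ⊥
  hangs-from-two-cores {f₁} {f₂} {s} {t} {t′} {y} core-s core-y s≢y j₁ H₁ j₂ H₂ same with separating-edge s≢y
  ... | h , Th , shy = not-¬ (side-step (Hidden.tree-edge H₂) f₂≢h j₂ sht′) shy
    where
    f₁≢h : f₁ ≢ h
    f₁≢h refl = separator-hides-nothing core-s core-y shy H₁
    f₂≢h : f₂ ≢ h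
    f₂≢h refl = separator-hides-nothing core-s core-y shy H₂
    sht′ : side h s t′ ≡ true
    sht′ = trans (separator-respects core-s core-y Th shy t′ t (sym same))
                 (side-step (Hidden.tree-edge H₁) f₁≢h j₁ (side-refl h s))

  leaves-from-core : ∀ {f u v r} → T f ≡ true → Joins G f u v → block u ≢ block v → Core r → block r ≡ block u → u ≡ r
  leaves-from-core Tf j u≢v core-r r∈u with core? _
  ... | yes core-u = Core-unique core-u core-r (sym r∈u)
  ... | no ¬core-u = ⊥-elim (no-core-beside Tf j u≢v ¬core-u core-r r∈u)

-- Tree links between cyclically ordered blocks

module BlockSets (G : Multigraph) {b : ℕ} (block : Fin (n G) → Fin b) (Z : Fin b → VSet G)
  (Z-block : ∀ {i v} → (Z i v ≡ true) ⇔ (block v ≡ i)) where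

  Z-true : ∀ {i v} → block v ≡ i → Z i v ≡ true
  Z-true = Equivalence.from Z-block

  Z-false : ∀ {i v} → block v ≢ i → Z i v ≡ false
  Z-false v∉i = ¬-not (v∉i ∘ Equivalence.to Z-block)

  record Between (i j : Fin b) (e : Fin (m G)) : Set where
    field
      {from to}  : Fin (n G)
      joins      : Joins G e from to
      from-block : block from ≡ i
      to-block   : block to ≡ j

  Between-reverse : ∀ {i j e} → Between i j e → Between j i e
  Between-reverse B = record { joins = Joins-sym G joins ; from-block = to-block ; to-block = from-block }
    where open Between B

  Between⇒crosses : ∀ {i j e} → i ≢ j → Between i j e → cross G (Z i) e ∧ cross G (Z j) e ≡ true
  Between⇒crosses {i} {j} i≢j B = cong₂ _∧_
    (trans (cross-Joins G (Z i) joins) (cong₂ _xor_ (Z-true from-block) (Z-false λ to∈i → i≢j (trans (sym to∈i) to-block))))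
    (trans (cross-Joins G (Z j) joins) (cong₂ _xor_ (Z-false λ from∈j → i≢j (trans (sym from-block) from∈j)) (Z-true to-block)))
    where open Between B

  crosses⇒Between : ∀ {i j e} → i ≢ j → cross G (Z i) e ∧ cross G (Z j) e ≡ true → Between i j e
  crosses⇒Between {i} {j} {e} i≢j crosses with ∧≡true crosses | block (proj₁ (ends G e)) ≟ i
  ... | cross-i , cross-j | yes p∈i = record
    { joins = Joins-ends G e ; from-block = p∈i
    ; to-block = Equivalence.to Z-block (xor≡true-right (Z-false λ p∈j → i≢j (trans (sym p∈i) p∈j)) cross-j) }
  ... | cross-i , cross-j | no p∉i = record
    { joins = Joins-sym G (Joins-ends G e) ; from-block = q∈i
    ; to-block = Equivalence.to Z-block (xor≡true-left (Z-false λ q∈j → i≢j (trans (sym q∈i) q∈j)) cross-j) }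
    where
    q∈i : block (proj₂ (ends G e)) ≡ i
    q∈i = Equivalence.to Z-block (xor≡true-right (Z-false p∉i) cross-i)

module CyclicBlocks {G : Multigraph} {T : ESet G} (tree : IsSpanningTree G T) {k : ℕ}
  (block : Fin (n G) → Fin (3 + k))
  (Z : Fin (3 + k) → VSet G) (Z-block : ∀ {i v} → (Z i v ≡ true) ⇔ (block v ≡ i))
  (occupied : ∀ i → ∃ λ v → block v ≡ i)
  (adjacent : ∀ {e u v} → Joins G e u v → block u ≢ block v → block v ≡ next (block u) ⊎ block u ≡ next (block v))
  (shape : ∀ {e} x → T e ≡ true → BlockShape block (SpanningTree.side tree e x)) where

  open SpanningTree tree

  private
    V = Fin (n G)
    E = Fin (m G)
    ℓ = 3 + k

  third : ∀ b₁ b₂ → ∃ λ v → block v ≢ b₁ × block v ≢ b₂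
  third b₁ b₂ with avoid-two b₁ b₂
  ... | i , i≢b₁ , i≢b₂ with occupied i
  ...   | v , v∈i = v , i≢b₁ ∘ trans (sym v∈i) , i≢b₂ ∘ trans (sym v∈i)

  open HiddenSides tree block shape third

  open BlockSets G block Z Z-block public

  record TreeLink (i j : Fin ℓ) : Set where
    field
      edge      : E
      tree-edge : T edge ≡ true
      between   : Between i j edge
    open Between between public

  TreeLink-reverse : ∀ {i j} → TreeLink i j → TreeLink j i
  TreeLink-reverse L = record { tree-edge = tree-edge ; between = Between-reverse between }
    where open TreeLink L

  TreeLink⇒TδΔ : ∀ {i j} → i ≢ j → (L : TreeLink i j) → TδΔ G T (Z i) (Z j) (TreeLink.edge L) ≡ true
  TreeLink⇒TδΔ i≢j L = cong₂ _∧_ (TreeLink.tree-edge L) (Between⇒crosses i≢j (TreeLink.between L))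

  TδΔ⇒TreeLink : ∀ {i j e} → i ≢ j → TδΔ G T (Z i) (Z j) e ≡ true → Σ (TreeLink i j) λ L → TreeLink.edge L ≡ e
  TδΔ⇒TreeLink i≢j h = let (Te , crosses) = ∧≡true h in
    record { tree-edge = Te ; between = crosses⇒Between i≢j crosses } , refl

  private
    rep : Fin ℓ → V
    rep i = proj₁ (occupied i)

    rep-block : ∀ i → block (rep i) ≡ i
    rep-block i = proj₂ (occupied i)

    crossing-link : ∀ {h r i j} → T h ≡ true → Respects (side h r) → (L : TreeLink i j) →
                    side h r (rep i) ≢ side h r (rep j) → TreeLink.edge L ≡ h
    crossing-link {h} {r} {i} {j} Th resp L differ = side-crossing tree-edge joins λ eq →
      differ (trans (resp (rep i) from (trans (rep-block i) (sym from-block)))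
             (trans eq (resp to (rep j) (trans to-block (sym (rep-block j))))))
      where open TreeLink L

    crossed-once : ∀ {h r} → T h ≡ true → (resp-h : Respects (side h r)) → (ring : ∀ i → TreeLink i (next i)) →
                   ∀ {i₁ i₂} → ChangesAt (side h r ∘ rep) i₁ → ChangesAt (side h r ∘ rep) i₂ → i₁ ≡ i₂
    crossed-once {h} Th resp-h ring {i₁} {i₂} changes₁ changes₂
      with Joins-unique G (joins-h (ring i₁) changes₁) (joins-h (ring i₂) changes₂)
      where
      joins-h : ∀ {i} (L : TreeLink i (next i)) → ChangesAt (side h _ ∘ rep) i → Joins G h (TreeLink.from L) (TreeLink.to L)
      joins-h L changes = subst (λ f → Joins G f _ _) (crossing-link Th resp-h L changes) (TreeLink.joins L)
    ... | inj₁ (same , _) = trans (sym (TreeLink.from-block (ring i₁))) (trans (cong block same) (TreeLink.from-block (ring i₂)))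
    ... | inj₂ (from≡to , to≡from) = contradiction (trans (sym (cong next i₁≡next-i₂)) next-i₁≡i₂) (next²≢ i₂)
      where
      i₁≡next-i₂ : i₁ ≡ next i₂
      i₁≡next-i₂ = trans (sym (TreeLink.from-block (ring i₁))) (trans (cong block from≡to) (TreeLink.to-block (ring i₂)))
      next-i₁≡i₂ : next i₁ ≡ i₂
      next-i₁≡i₂ = trans (sym (TreeLink.to-block (ring i₁))) (trans (cong block to≡from) (TreeLink.from-block (ring i₂)))

    separated-blocks-differ : ∀ {h r r′} → Respects (side h r) → side h r r′ ≡ false →
                              side h r (rep (block r)) ≢ side h r (rep (block r′))
    separated-blocks-differ {h} {r} {r′} resp-h shr′ eq = not-¬ (begin
      side h r r′                   ≡⟨ resp-h (rep (block r′)) r′ (rep-block (block r′)) ⟨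
      side h r (rep (block r′))     ≡⟨ eq ⟨
      side h r (rep (block r))      ≡⟨ resp-h (rep (block r)) r (rep-block (block r)) ⟩
      side h r r                    ≡⟨ side-refl h r ⟩
      true                          ∎) shr′
      where open ≡-Reasoning

    two-cores⇒no-ring : ∀ {r r′} → Core r → Core r′ → r ≢ r′ → ¬ (∀ i → TreeLink i (next i))
    two-cores⇒no-ring {r} {r′} core core′ r≢r′ ring =
      let (h , Th , shr′) = separating-edge r≢r′
          resp-h = unhidden-separated⇒Respects Th (core h) (core′ h) shr′
          (i₁ , changes₁) = change-exists (side h r ∘ rep) (block r) (block r′) (separated-blocks-differ resp-h shr′)
          (i₂ , i₂≢i₁ , changes₂) = another-change (side h r ∘ rep) i₁ changes₁
      in i₂≢i₁ (sym (crossed-once Th resp-h ring changes₁ changes₂))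

    unique-core⇒no-ring : ∀ {r} → (∀ v → Core v → v ≡ r) → ¬ (∀ i → TreeLink i (next i))
    unique-core⇒no-ring {r} unique ring = from-hanging (hang ¬core-u)
      where
      L = ring (next (block r))
      open TreeLink L renaming (from to u ; to to u′ ; from-block to u∈ ; to-block to u′∈)
      ¬core-u : ¬ Core u
      ¬core-u core-u = next≢ (block r) (trans (sym u∈) (cong block (unique _ core-u)))
      from-hanging : Hanging u → ⊥
      from-hanging record { edge = e ; hidden = H ; endpoints = ε ; far-core = far-core } =
        next≢ (next (block r)) (trans (sym u′∈) (trans (Hidden.within H u′ u′∈side) u∈))
        where
        far≡r : Ends.far ε ≡ r
        far≡r = unique _ far-core
        edge≢e : edge ≢ e
        edge≢e refl with Joins-unique G joins (Ends.joins ε)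
        ... | inj₁ (_ , u′≡far) = next²≢ (block r) (trans (sym u′∈) (cong block (trans u′≡far far≡r)))
        ... | inj₂ (u≡far , _)  = next≢ (block r) (trans (sym u∈) (cong block (trans u≡far far≡r)))
        u′∈side : side e u u′ ≡ true
        u′∈side = side-step tree-edge edge≢e joins (side-refl e u)

  no-ring : ¬ (∀ i → TreeLink i (next i))
  no-ring with Core-exists (rep zero)
  ... | r , core-r with any? (λ v → core? v ×-dec ¬? (v ≟ r))
  ...   | yes (r′ , core′ , r′≢r) = two-cores⇒no-ring core-r core′ (r′≢r ∘ sym)
  ...   | no ¬other = unique-core⇒no-ring λ v core-v → decidable-stable (v ≟ r) λ v≢r → ¬other (v , core-v , v≢r)

  opaque
    gap : ∃ λ g → ∀ e → TδΔ G T (Z g) (Z (prev g)) e ≡ false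
    gap with any? (λ g → all? (λ e → TδΔ G T (Z g) (Z (prev g)) e ≟ᵇ false))
    ... | yes found = found
    ... | no ¬found = ⊥-elim (no-ring link)
      where
      link : ∀ i → TreeLink i (next i)
      link i with ¬∀⟶∃¬ (m G) _ (λ e → TδΔ G T (Z (next i)) (Z (prev (next i))) e ≟ᵇ false) (λ none → ¬found (next i , none))
      ... | e , ¬false with TδΔ⇒TreeLink (prev≢ (next i) ∘ sym) (¬-not ¬false)
      ...   | L , _ = subst (λ j → TreeLink j (next i)) (prev-next i) (TreeLink-reverse L)

  g : Fin ℓ
  g = proj₁ gap

  pos : V → ℕ
  pos v = offset g (block v)

  pos<ℓ : ∀ v → pos v < ℓ
  pos<ℓ v = offset<N g (block v)

  shift-pos : ∀ v → shift g (pos v) ≡ block v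
  shift-pos v = shift-offset g (block v)

  pos-of : ∀ {v p} → block v ≡ shift g p → p < ℓ → pos v ≡ p
  pos-of v∈p p<ℓ = trans (cong (offset g) v∈p) (offset-shift g p<ℓ)

  next-shift : ∀ p → next (shift g p) ≡ shift g (suc p)
  next-shift p = trans (shift-+ g p 1) (cong (shift g) (+-comm p 1))

  private
    step-over : ∀ p → suc p < ℓ → ∀ {f y y′} → T f ≡ true → Joins G f y y′ → pos y ≤ p → ¬ pos y′ ≤ p →
                TreeLink (shift g p) (shift g (suc p))
    step-over p p+1<ℓ {f} {y} {y′} Tf j y≤p y′≰p = across (adjacent j λ same → y′≰p (subst (_≤ p) (cong (offset g) same) y≤p))
      where
      across : block y′ ≡ next (block y) ⊎ block y ≡ next (block y′) → TreeLink (shift g p) (shift g (suc p))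
      across (inj₁ forward) = record { tree-edge = Tf ; between = record
        { joins = j ; from-block = y∈p ; to-block = trans forward (trans (cong next y∈p) (next-shift p)) } }
        where
        y′-pos : pos y′ ≡ suc (pos y)
        y′-pos = pos-of (trans forward (trans (cong next (sym (shift-pos y))) (next-shift (pos y))))
                        (≤-trans (s≤s (s≤s y≤p)) p+1<ℓ)
        y∈p : block y ≡ shift g p
        y∈p = trans (sym (shift-pos y)) (cong (shift g) (≤-antisym y≤p (≤-pred (subst (p <_) y′-pos (≰⇒> y′≰p)))))
      across (inj₂ backward) with suc (pos y′) <? ℓ
      ... | yes in-range = ⊥-elim (y′≰p (≤-trans (n≤1+n _) (subst (_≤ p) (pos-of y-next in-range) y≤p)))
        where
        y-next : block y ≡ shift g (suc (pos y′))
        y-next = trans backward (trans (cong next (sym (shift-pos y′))) (next-shift (pos y′)))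
      ... | no out-of-range = contradiction (TreeLink⇒TδΔ (prev≢ g ∘ sym) wrap) (not-¬ (proj₂ gap f))
        where
        y′-last : pos y′ ≡ 2 + k
        y′-last = ≤-antisym (≤-pred (pos<ℓ y′)) (≤-pred (≤-pred (≰⇒> out-of-range)))
        y′∈prev : block y′ ≡ prev g
        y′∈prev = trans (sym (shift-pos y′)) (cong (shift g) y′-last)
        wrap : TreeLink g (prev g)
        wrap = record { tree-edge = Tf ; between = record { joins = j ; to-block = y′∈prev
                      ; from-block = trans backward (trans (cong next y′∈prev) (next-prev g)) } }

  -- The tree path from block g to block g - 1 has to step over every other boundary.
  opaque
    link : ∀ p → suc p < ℓ → TreeLink (shift g p) (shift g (suc p))
    link p p+1<ℓ = step-over p p+1<ℓ edge∈S joins (⌊⌋-sound (pos inner ≤? p) inner∈P)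
                             (λ ≤p → not-¬ (⌊⌋-complete (pos outer ≤? p) ≤p) outer∉P)
      where
      Before : VSet G
      Before v = ⌊ pos v ≤? p ⌋
      from-g : Before (rep g) ≡ true
      from-g = ⌊⌋-complete (pos (rep g) ≤? p) (subst (_≤ p) (sym (pos-of (trans (rep-block g) (sym (shift-0 g))) (s≤s z≤n))) z≤n)
      to-prev : Before (rep (prev g)) ≡ false
      to-prev = ⌊⌋-false (pos (rep (prev g)) ≤? p) λ ≤p →
        <-irrefl refl (≤-trans p+1<ℓ (s≤s (subst (_≤ p) (pos-of (rep-block (prev g)) ≤-refl) ≤p)))
      open Exit (exit G Before (proj₁ tree (rep g) (rep (prev g))) from-g to-prev)

  TreeLink-from-core : ∀ {i j r} (L : TreeLink i j) → i ≢ j → Core r → block r ≡ i → TreeLink.from L ≡ r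
  TreeLink-from-core L i≢j core-r r∈i = leaves-from-core tree-edge joins (λ eq → i≢j (trans (sym from-block) (trans eq to-block)))
                                                         core-r (trans r∈i (sym from-block))
    where open TreeLink L

  TreeLink-to-core : ∀ {i j r} (L : TreeLink i j) → i ≢ j → Core r → block r ≡ j → TreeLink.to L ≡ r
  TreeLink-to-core L i≢j = TreeLink-from-core (TreeLink-reverse L) (i≢j ∘ sym)

  positions-differ : ∀ {a b u v} → a < ℓ → b < ℓ → a ≢ b → block u ≡ shift g a → block v ≡ shift g b → block u ≢ block v
  positions-differ a<ℓ b<ℓ a≢b u∈a v∈b eq = a≢b (shift-injective g a<ℓ b<ℓ (trans (sym u∈a) (trans eq v∈b)))

  opaque
    core-in-middle : ∀ j → j ≤ k → ∃ λ r → Core r × block r ≡ shift g (suc j)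
    core-in-middle j j≤k with any? (λ v → core? v ×-dec (block v ≟ shift g (suc j)))
    ... | yes (r , core-r , r∈) = r , core-r , r∈
    ... | no ¬found = ⊥-elim (hangs-from-two-cores (proj₁ hanging₁) (proj₁ hanging₂) s≢y′ joins₁ (proj₂ hanging₁)
                                                   joins₂ (proj₂ hanging₂) (trans (TreeLink.to-block L₁) (sym (TreeLink.from-block L₂))))
      where
      j+2<ℓ : suc (suc j) < ℓ
      j+2<ℓ = s≤s (s≤s (s≤s j≤k))
      j+1<ℓ : suc j < ℓ
      j+1<ℓ = ≤-trans (n≤1+n _) j+2<ℓ
      j<ℓ : j < ℓ
      j<ℓ = ≤-trans (n≤1+n _) j+1<ℓ
      L₁ : TreeLink (shift g j) (shift g (suc j))
      L₁ = link j j+1<ℓ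
      L₂ : TreeLink (shift g (suc j)) (shift g (suc (suc j)))
      L₂ = link (suc j) j+2<ℓ
      open TreeLink L₁ using () renaming (from to s ; to to t ; joins to joins₁)
      open TreeLink L₂ using () renaming (from to t′ ; to to y′ ; joins to joins₂)
      ¬core : ∀ {v} → block v ≡ shift g (suc j) → ¬ Core v
      ¬core v∈ core-v = ¬found (_ , core-v , v∈)
      hanging₁ : Core s × Hidden (TreeLink.edge L₁) t
      hanging₁ = hanging-edge (TreeLink.tree-edge L₁) (Joins-sym G joins₁)
        (positions-differ j+1<ℓ j<ℓ 1+n≢n (TreeLink.to-block L₁) (TreeLink.from-block L₁)) (¬core (TreeLink.to-block L₁))
      hanging₂ : Core y′ × Hidden (TreeLink.edge L₂) t′
      hanging₂ = hanging-edge (TreeLink.tree-edge L₂) joins₂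
        (positions-differ j+1<ℓ j+2<ℓ (<⇒≢ (n<1+n (suc j))) (TreeLink.from-block L₂) (TreeLink.to-block L₂))
        (¬core (TreeLink.from-block L₂))
      s≢y′ : s ≢ y′
      s≢y′ s≡y′ = positions-differ j<ℓ j+2<ℓ (<⇒≢ (s≤s (n≤1+n j))) (TreeLink.from-block L₁) (TreeLink.to-block L₂) (cong block s≡y′)

  first-link : TreeLink (shift g 0) (shift g 1)
  first-link = link 0 (s≤s (s≤s z≤n))

  last-link : TreeLink (shift g (suc k)) (shift g (2 + k))
  last-link = link (suc k) ≤-refl

  w : ℕ → V
  w zero = TreeLink.from first-link
  w (suc j) with j ≤? k
  ... | yes j≤k = proj₁ (core-in-middle j j≤k)
  ... | no _    = TreeLink.to last-link

  w-middle : ∀ j → j ≤ k → Core (w (suc j)) × block (w (suc j)) ≡ shift g (suc j)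
  w-middle j j≤k with j ≤? k
  ... | yes j≤k′ = proj₂ (core-in-middle j j≤k′)
  ... | no j≰k   = contradiction j≤k j≰k

  w-last : w (2 + k) ≡ TreeLink.to last-link
  w-last with suc k ≤? k
  ... | yes k+1≤k = contradiction k+1≤k 1+n≰n
  ... | no _      = refl

  w∈Z : ∀ j → j < ℓ → Z (shift g j) (w j) ≡ true
  w∈Z zero    _   = Z-true (TreeLink.from-block first-link)
  w∈Z (suc j) j<ℓ with j ≤? k
  ... | yes j≤k = Z-true (proj₂ (proj₂ (core-in-middle j j≤k)))
  ... | no j≰k  = subst (λ i → Z (shift g (suc i)) (TreeLink.to last-link) ≡ true) (sym j≡k+1) (Z-true (TreeLink.to-block last-link))
    where
    j≡k+1 : j ≡ suc k
    j≡k+1 = ≤-antisym (≤-pred (≤-pred j<ℓ)) (≰⇒> j≰k)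

  middle-links : ∀ j → 1 ≤ j → j ≤ k →
    Σ E λ e → Joins G e (w j) (w (suc j)) ×
      (∀ e′ → (TδΔ G T (Z (shift g j)) (Z (shift g (suc j))) e′ ≡ true) ⇔ (e′ ≡ e))
  middle-links (suc j) _ j+1≤k = TreeLink.edge L , joins-w L , λ e′ → mk⇔ (to e′) from
    where
    i₁ = shift g (suc j)
    i₂ = shift g (suc (suc j))
    j+2<ℓ : suc (suc j) < ℓ
    j+2<ℓ = s≤s (s≤s (≤-trans j+1≤k (n≤1+n k)))
    L : TreeLink i₁ i₂
    L = link (suc j) j+2<ℓ
    i₁≢i₂ : i₁ ≢ i₂
    i₁≢i₂ = <⇒≢ (n<1+n (suc j)) ∘ shift-injective g (≤-trans (n≤1+n _) j+2<ℓ) j+2<ℓ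
    joins-w : (L′ : TreeLink i₁ i₂) → Joins G (TreeLink.edge L′) (w (suc j)) (w (suc (suc j)))
    joins-w L′ = subst₂ (Joins G (TreeLink.edge L′))
      (TreeLink-from-core L′ i₁≢i₂ (proj₁ at₁) (proj₂ at₁)) (TreeLink-to-core L′ i₁≢i₂ (proj₁ at₂) (proj₂ at₂)) (TreeLink.joins L′)
      where
      at₁ = w-middle j (≤-trans (n≤1+n j) j+1≤k)
      at₂ = w-middle (suc j) j+1≤k
    to : ∀ e′ → TδΔ G T (Z i₁) (Z i₂) e′ ≡ true → e′ ≡ TreeLink.edge L
    to e′ crosses with TδΔ⇒TreeLink i₁≢i₂ crosses
    ... | L′ , refl = tree-edge-unique (TreeLink.tree-edge L) (TreeLink.tree-edge L′) (joins-w L) (joins-w L′)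
    from : ∀ {e′} → e′ ≡ TreeLink.edge L → TδΔ G T (Z i₁) (Z i₂) e′ ≡ true
    from refl = TreeLink⇒TδΔ i₁≢i₂ L

  first-crossing : Σ E λ e → Joins G e (w 0) (w 1) × TδΔ G T (Z g) (Z (shift g 1)) e ≡ true ×
                     (∀ e′ → TδΔ G T (Z g) (Z (shift g 1)) e′ ≡ true → Incident G e′ (w 1))
  first-crossing = edge , subst (Joins G edge from) (to-w₁ L) joins , TreeLink⇒TδΔ g≢g+1 L , incident
    where
    L : TreeLink g (shift g 1)
    L = record { TreeLink first-link ; between = record { Between (TreeLink.between first-link)
                                                        ; from-block = trans (TreeLink.from-block first-link) (shift-0 g) } }
    open TreeLink L
    g≢g+1 : g ≢ shift g 1
    g≢g+1 = next≢ g ∘ sym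
    to-w₁ : (L′ : TreeLink g (shift g 1)) → TreeLink.to L′ ≡ w 1
    to-w₁ L′ = TreeLink-to-core L′ g≢g+1 (proj₁ (w-middle 0 z≤n)) (proj₂ (w-middle 0 z≤n))
    incident : ∀ e′ → TδΔ G T (Z g) (Z (shift g 1)) e′ ≡ true → Incident G e′ (w 1)
    incident e′ crosses with TδΔ⇒TreeLink g≢g+1 crosses
    ... | L′ , refl = subst (Incident G _) (to-w₁ L′) (Joins⇒Incident G (TreeLink.joins L′))

  last-crossing : Σ E λ e → Joins G e (w (suc k)) (w (2 + k)) ×
                    TδΔ G T (Z (shift g (2 + k))) (Z (shift g (suc k))) e ≡ true ×
                    (∀ e′ → TδΔ G T (Z (shift g (2 + k))) (Z (shift g (suc k))) e′ ≡ true → Incident G e′ (w (suc k)))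
  last-crossing = edge , subst₂ (Joins G edge) (from-w (TreeLink-reverse last-link)) (sym w-last) joins ,
                  TreeLink⇒TδΔ (i₁≢i₂ ∘ sym) (TreeLink-reverse last-link) , incident
    where
    open TreeLink last-link
    i₁≢i₂ : shift g (suc k) ≢ shift g (2 + k)
    i₁≢i₂ = <⇒≢ (n<1+n (suc k)) ∘ shift-injective g (≤-trans (n≤1+n _) ≤-refl) ≤-refl
    from-w : (L′ : TreeLink (shift g (2 + k)) (shift g (suc k))) → TreeLink.to L′ ≡ w (suc k)
    from-w L′ = TreeLink-to-core L′ (i₁≢i₂ ∘ sym) (proj₁ (w-middle k ≤-refl)) (proj₂ (w-middle k ≤-refl))
    incident : ∀ e′ → TδΔ G T (Z (shift g (2 + k))) (Z (shift g (suc k))) e′ ≡ true → Incident G e′ (w (suc k))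
    incident e′ crosses with TδΔ⇒TreeLink (i₁≢i₂ ∘ sym) crosses
    ... | L′ , refl = subst (Incident G _) (from-w L′) (Joins⇒Incident G (TreeLink.joins L′))

  gap-empty : ∀ e → TδΔ G T (Z g) (Z (shift g (2 + k))) e ≡ false
  gap-empty = proj₂ gap

-- From the cactus to G

xor-interchange : ∀ a b c d → (a xor b) xor (c xor d) ≡ (a xor c) xor (b xor d)
xor-interchange a b c d = begin
  (a xor b) xor (c xor d)   ≡⟨ xor-assoc a b (c xor d) ⟩
  a xor (b xor (c xor d))   ≡⟨ cong (a xor_) (xor-assoc b c d) ⟨
  a xor ((b xor c) xor d)   ≡⟨ cong (λ x → a xor (x xor d)) (xor-comm b c) ⟩
  a xor ((c xor b) xor d)   ≡⟨ cong (a xor_) (xor-assoc c b d) ⟩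
  a xor (c xor (b xor d))   ≡⟨ xor-assoc a c (b xor d) ⟨
  (a xor c) xor (b xor d)   ∎
  where open ≡-Reasoning

cut-of-disjoint-union : ∀ G (X Y : VSet G) → (∀ v → X v ∧ Y v ≡ false) →
  count (cross G X) + count (cross G Y) ≡ count (cross G (λ v → X v ∨ Y v)) + 2 * count (λ e → cross G X e ∧ cross G Y e)
cut-of-disjoint-union G X Y disjoint =
  trans (count-xor (cross G X) (cross G Y)) (cong (_+ 2 * count (λ e → cross G X e ∧ cross G Y e)) (count-cong cross-xor))
  where
  ∨≡xor : ∀ v → X v ∨ Y v ≡ X v xor Y v
  ∨≡xor v with X v | Y v | disjoint v
  ... | true  | false | _  = refl
  ... | false | _     | _  = refl
  ... | true  | true  | ()
  cross-xor : ∀ e → cross G X e xor cross G Y e ≡ cross G (λ v → X v ∨ Y v) e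
  cross-xor e = trans (xor-interchange (X u) (X v) (Y u) (Y v)) (sym (cong₂ _xor_ (∨≡xor u) (∨≡xor v)))
    where
    u = proj₁ (ends G e)
    v = proj₂ (ends G e)

halves-leave-nothing : ∀ {K a b c} → 2 * a ≡ K → 2 * b ≡ K → a + (b + c) ≤ K → c ≡ 0
halves-leave-nothing {K} {a} {b} {c} 2a≡K 2b≡K a+b+c≤K =
  n≤0⇒n≡0 (+-cancelˡ-≤ a c 0 (+-cancelˡ-≤ a (a + c) (a + 0) (subst (λ x → a + (x + c) ≤ 2 * a) (sym a≡b) a+b+c≤2a)))
  where
  a≡b : a ≡ b
  a≡b = *-cancelˡ-≡ a b 2 (trans 2a≡K (sym 2b≡K))
  a+b+c≤2a : a + (b + c) ≤ 2 * a
  a+b+c≤2a = subst (a + (b + c) ≤_) (sym 2a≡K) a+b+c≤K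

module RepresentedCycle {K : ℕ} {G : Multigraph} (kec : KEdgeConnected G K) (R : CactusRep G K) (k : ℕ)
  (a : Fin (3 + k) → Fin (n (CactusRep.cactus R))) (c : Fin (3 + k) → Fin (m (CactusRep.cactus R)))
  (cyc : IsCycle (CactusRep.cactus R) (2 + k) a c)
  (Q : Fin (3 + k) → VSet (CactusRep.cactus R))
  (Q-spec : ∀ i x → (Q i x ≡ true) ⇔
     Reach (CactusRep.cactus R) (λ f → not ⌊ f ≟ c (shift i (2 + k)) ⌋ ∧ not ⌊ f ≟ c i ⌋) (a i) x) where

  open CactusRep R
  open CactusCycle cactus isCactus k a c cyc Q Q-spec

  private
    ℓ = 3 + k

  Z : Fin ℓ → VSet G
  Z i v = Q i (φ v)

  Z-block : ∀ {i v} → (Z i v ≡ true) ⇔ (block (φ v) ≡ i)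
  Z-block {i} {v} = mk⇔ block-unique (λ eq → subst (λ j → Q j (φ v) ≡ true) eq (Q-block (φ v)))

  open BlockSets G (block ∘ φ) Z Z-block

  two-cut⇒K-cut : ∀ X → IsTwoCut cactus X → IsKCut G K (X ∘ φ)
  two-cut⇒K-cut X two = Equivalence.from (represents (X ∘ φ)) (X , two , λ _ → refl)

  occupied : ∀ i → ∃ λ v → block (φ v) ≡ i
  occupied i = let (v , Zv) = proj₁ (two-cut⇒K-cut (Q i) (Q-isTwoCut i)) in v , block-unique Zv

  K-cut-shape : ∀ X → IsKCut G K X → BlockShape (block ∘ φ) X
  K-cut-shape X K-cut with Equivalence.to (represents X) K-cut
  ... | X′ , two , X≡X′∘φ with twoCut-shape X′ two
  ...   | respects r  = respects λ u v same → trans (X≡X′∘φ u) (trans (r (φ u) (φ v) same) (sym (X≡X′∘φ v)))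
  ...   | inside b h  = inside b λ v Xv → h (φ v) (trans (sym (X≡X′∘φ v)) Xv)
  ...   | outside b h = outside b λ v Xv → h (φ v) (trans (sym (X≡X′∘φ v)) Xv)

  private
    toward : Fin ℓ → Fin ℓ → ESet G
    toward i j e = cross G (Z i) e ∧ cross G (Z j) e

    Z-cut : ∀ i → count (cross G (Z i)) ≡ K
    Z-cut i = proj₂ (proj₂ (two-cut⇒K-cut (Q i) (Q-isTwoCut i)))

    toward-next : ∀ i → 2 * count (toward i (next i)) ≡ K
    toward-next i = sym (+-cancelˡ-≡ K K (2 * count (toward i (next i))) (begin
      K + K                                                      ≡⟨ cong₂ _+_ (Z-cut i) (Z-cut (next i)) ⟨
      count (cross G (Z i)) + count (cross G (Z (next i)))       ≡⟨ cut-of-disjoint-union G (Z i) (Z (next i)) disjoint ⟩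
      count (cross G (λ v → Z i v ∨ Z (next i) v)) + 2 * count (toward i (next i))
        ≡⟨ cong (_+ 2 * count (toward i (next i))) (proj₂ (proj₂ (two-cut⇒K-cut (λ x → Q i x ∨ Q (next i) x) (Q∪Q-next-isTwoCut i)))) ⟩
      K + 2 * count (toward i (next i))                          ∎))
      where
      open ≡-Reasoning
      disjoint : ∀ v → Z i v ∧ Z (next i) v ≡ false
      disjoint v = ¬-not λ both → let (Zi , Znext) = ∧≡true both in next≢ i (sym (Q-disjoint Zi Znext))

    three-blocks : ∀ {i x y} → x ≢ i → y ≢ i → x ≢ y → ∀ e → toward i x e ∧ toward i y e ≡ false
    three-blocks {i} {x} {y} x≢i y≢i x≢y e =
      ¬-not λ both → let (tx , ty) = ∧≡true both in apart (crosses⇒Between (x≢i ∘ sym) tx) (crosses⇒Between (y≢i ∘ sym) ty)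
      where
      apart : Between i x e → Between i y e → ⊥
      apart Bx By with Joins-unique G (Between.joins Bx) (Between.joins By)
      ... | inj₁ (_ , same-to) = x≢y (trans (sym (Between.to-block Bx)) (trans (cong (block ∘ φ) same-to) (Between.to-block By)))
      ... | inj₂ (from≡to , _) = y≢i (trans (sym (Between.to-block By)) (trans (cong (block ∘ φ) (sym from≡to)) (Between.from-block Bx)))

    toward-prev : ∀ i → 2 * count (toward i (prev i)) ≡ K
    toward-prev i = trans (cong (2 *_) (count-cong λ e → trans (∧-comm (cross G (Z i) e) (cross G (Z (prev i)) e))
                                                              (cong (λ j → toward (prev i) j e) (sym (next-prev i)))))
                          (toward-next (prev i))

  no-distant-edges : ∀ {i j} → j ≢ i → j ≢ next i → i ≢ next j → count (toward i j) ≡ 0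
  no-distant-edges {i} {j} j≢i j≢next-i i≢next-j = halves-leave-nothing {K} {count t₁} {count t₂} (toward-next i) (toward-prev i) (begin
    count t₁ + (count t₂ + count t₃)          ≡⟨ cong (count t₁ +_) (count-∨ t₂ t₃ (three-blocks (prev≢ i) j≢i prev≢j)) ⟨
    count t₁ + count (λ e → t₂ e ∨ t₃ e)      ≡⟨ count-∨ t₁ (λ e → t₂ e ∨ t₃ e) disjoint ⟨
    count (λ e → t₁ e ∨ (t₂ e ∨ t₃ e))        ≤⟨ count-mono within ⟩
    count (cross G (Z i))                     ≡⟨ Z-cut i ⟩
    K                                         ∎)
    where
    open ≤-Reasoning
    t₁ = toward i (next i)
    t₂ = toward i (prev i)
    t₃ = toward i j
    prev≢j : prev i ≢ j
    prev≢j eq = i≢next-j (trans (sym (next-prev i)) (cong next eq))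
    disjoint : ∀ e → t₁ e ∧ (t₂ e ∨ t₃ e) ≡ false
    disjoint e = trans (∧-distribˡ-∨ (t₁ e) (t₂ e) (t₃ e))
      (cong₂ _∨_ (three-blocks (next≢ i) (prev≢ i) (prev≢next i ∘ sym) e) (three-blocks (next≢ i) j≢i (j≢next-i ∘ sym) e))
    within : (λ e → t₁ e ∨ (t₂ e ∨ t₃ e)) ⊆ cross G (Z i)
    within e t with ∨≡true t
    ... | inj₁ t₁e = proj₁ (∧≡true t₁e)
    ... | inj₂ t₂₃ with ∨≡true t₂₃
    ...   | inj₁ t₂e = proj₁ (∧≡true t₂e)
    ...   | inj₂ t₃e = proj₁ (∧≡true t₃e)

  adjacent : ∀ {e u v} → Joins G e u v → block (φ u) ≢ block (φ v) →
             block (φ v) ≡ next (block (φ u)) ⊎ block (φ u) ≡ next (block (φ v))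
  adjacent {e} {u} {v} j u≢v with block (φ v) ≟ next (block (φ u)) | block (φ u) ≟ next (block (φ v))
  ... | yes forward | _ = inj₁ forward
  ... | no _ | yes backward = inj₂ backward
  ... | no v≢next | no u≢next = contradiction
    (Between⇒crosses u≢v (record { joins = j ; from-block = refl ; to-block = refl }))
    (not-¬ (count≡0⇒false _ (no-distant-edges (u≢v ∘ sym) v≢next u≢next) e))

mainTheorem7 : (K : ℕ) → 2 ∣ K → 1 ≤ K →
  (G : Multigraph) → KEdgeConnected G K →
  (R : CactusRep G K) →
  (T : ESet G) → IsSpanningTree G T → CongestionAtMost G T K →
  -- cycle a_0 … a_{ℓ-1} of the cactus, ℓ = k + 3 ≥ 3, links c_i = (a_i, a_{i+1})
  (k : ℕ) →
  (a : Fin (suc (suc (suc k))) → Fin (n (CactusRep.cactus R))) →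
  (c : Fin (suc (suc (suc k))) → Fin (m (CactusRep.cactus R))) →
  IsCycle (CactusRep.cactus R) (suc (suc k)) a c →
  -- Q i = shore containing a_i of the 2-cut {c_{i-1}, c_i}
  (Q : Fin (suc (suc (suc k))) → VSet (CactusRep.cactus R)) →
  (∀ i x → (Q i x ≡ true) ⇔
     Reach (CactusRep.cactus R)
       (λ f → not ⌊ f ≟ c (shift i (suc (suc k))) ⌋ ∧ not ⌊ f ≟ c i ⌋) (a i) x) →
  -- Z i = φ⁻¹(Q i);  index g+j is  shift g j,  w_{g+j} is  w j
  let Z : Fin (suc (suc (suc k))) → VSet G
      Z i v = Q i (CactusRep.φ R v)
  in
  Σ (Fin (suc (suc (suc k)))) λ g →
  Σ (ℕ → Fin (n G)) λ w →
    (∀ j → j < suc (suc (suc k)) → Z (shift g j) (w j) ≡ true) ×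
    -- (i)
    (∀ j → 1 ≤ j → j ≤ k →
      Σ (Fin (m G)) λ e → Joins G e (w j) (w (suc j)) ×
        (∀ e' → (TδΔ G T (Z (shift g j)) (Z (shift g (suc j))) e' ≡ true) ⇔ (e' ≡ e))) ×
    -- (ii)
    (Σ (Fin (m G)) λ e → Joins G e (w 0) (w 1) ×
        TδΔ G T (Z g) (Z (shift g 1)) e ≡ true ×
        (∀ e' → TδΔ G T (Z g) (Z (shift g 1)) e' ≡ true → Incident G e' (w 1))) ×
    (Σ (Fin (m G)) λ e → Joins G e (w (suc k)) (w (suc (suc k))) ×
        TδΔ G T (Z (shift g (suc (suc k)))) (Z (shift g (suc k))) e ≡ true ×
        (∀ e' → TδΔ G T (Z (shift g (suc (suc k)))) (Z (shift g (suc k))) e' ≡ true →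
           Incident G e' (w (suc k)))) ×
    -- (iii)
    (∀ e → TδΔ G T (Z g) (Z (shift g (suc (suc k)))) e ≡ false)
mainTheorem7 K _ _ G kec R T tree congestion k a c cyc Q Q-spec =
  g , w , w∈Z , middle-links , first-crossing , last-crossing , gap-empty
  where
  open RepresentedCycle kec R k a c cyc Q Q-spec
  open CactusCycle (CactusRep.cactus R) (CactusRep.isCactus R) k a c cyc Q Q-spec using (block)
  open CyclicBlocks tree (block ∘ CactusRep.φ R) Z Z-block occupied adjacent
         (λ x Te → K-cut-shape _ (SpanningTree.side-isKCut tree kec congestion x Te))
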